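{- For every $n\ge 5$, $\mu(M(P_n))=n+\left\lfloor \frac{n+1}{4}\right\rfloor$, where $P_n$ is the path on $n$ vertices.
   Context: All graphs are finite and simple. The Mycielskian $M(G)$ of a graph $G$ has vertex set $V(G)\cup V(G')\cup\{v^*\}$, where $V(G')=\{u': u\in V(G)\}$, and edge set $E(G)\cup\{uv': uv\in E(G)\}\cup\{v'v^*: v'\in V(G')\}$ (so for each edge $uv$ of $G$ both $uv'$ and $vu'$ are edges). Given $S\subseteq V(H)$, two vertices $x,y$ are $S$-visible if some shortest $x,y$-path in $H$ has no internal vertex in $S$; $S$ is a mutual-visibility set if every two vertices of $S$ are $S$-visible; $\mu(H)$ is the maximum size of a mutual-visibility set of $H$. -}

module Defs where

open import Data.Nat using (ℕ; zero; suc; _+_; _≤_)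
open import Data.Fin using (Fin; toℕ; splitAt)
open import Data.Fin.Subset using (Subset; _∈_; _∉_; ∣_∣)
open import Data.Sum using (_⊎_; inj₁; inj₂)
open import Data.Product using (Σ; _×_; ∃; ∃-syntax)
open import Data.Unit using (⊤)
open import Data.Empty using (⊥)
open import Data.List using (List; []; _∷_)
open import Data.List.Relation.Unary.All using (All)
open import Relation.Binary.PropositionalEquality using (_≡_)
open import Level using (0ℓ)

-- A finite graph on the vertex set Fin size, given by an adjacency relation.
-- (Simplicity: irreflexive and symmetric adjacency; the concrete graphs below
-- are simple by construction.)
record Graph : Set₁ where
  field
    size : ℕ
    Adj  : Fin size → Fin size → Set
open Graph public

data Walk (G : Graph) : Fin (size G) → Fin (size G) → ℕ → Set where
  []  : ∀ {x} → Walk G x x 0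
  _∷_ : ∀ {x y z k} → Adj G x y → Walk G y z k → Walk G x z (suc k)

initVerts : ∀ {G x y k} → Walk G x y k → List (Fin (size G))
initVerts []               = []
initVerts (_∷_ {x} e w)    = x ∷ initVerts w

inner : ∀ {G x y k} → Walk G x y k → List (Fin (size G))
inner []      = []
inner (e ∷ w) = initVerts w

-- w is a shortest x,y-path: no x,y-walk is shorter (a shortest walk is a path).
IsShortest : ∀ {G x y k} → Walk G x y k → Set
IsShortest {G} {x} {y} {k} w = ∀ k' → Walk G x y k' → k ≤ k'

Visible : (G : Graph) → Subset (size G) → Fin (size G) → Fin (size G) → Set
Visible G S x y =
  ∃[ k ] Σ (Walk G x y k) (λ w → IsShortest w × All (λ v → v ∉ S) (inner w))

MutualVisibility : (G : Graph) → Subset (size G) → Set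
MutualVisibility G S = ∀ x y → x ∈ S → y ∈ S → Visible G S x y

IsMu : (G : Graph) → ℕ → Set
IsMu G m =
  (Σ (Subset (size G)) (λ S → MutualVisibility G S × ∣ S ∣ ≡ m))
  × (∀ S → MutualVisibility G S → ∣ S ∣ ≤ m)

Path : ℕ → Graph
Path n = record { size = n ; Adj = λ i j → (toℕ j ≡ suc (toℕ i)) ⊎ (toℕ i ≡ suc (toℕ j)) }

-- Vertices of the Mycielskian: Fin (suc (N + N)); 0 is v*, then the
-- originals u (first block of N), then the copies u' (second block).
data MKind (N : ℕ) : Set where
  star : MKind N
  orig : Fin N → MKind N
  copy : Fin N → MKind N

classify : ∀ {N} → Fin (suc (N + N)) → MKind N
classify Fin.zero = star
classify {N} (Fin.suc i) with splitAt N i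
... | inj₁ u = orig u
... | inj₂ u = copy u

MAdj : (G : Graph) → MKind (size G) → MKind (size G) → Set
MAdj G (orig u) (orig v) = Adj G u v
MAdj G (orig u) (copy v) = Adj G u v
MAdj G (copy u) (orig v) = Adj G u v
MAdj G (copy u) star     = ⊤
MAdj G star     (copy v) = ⊤
MAdj G _        _        = ⊥

Mycielskian : Graph → Graph
Mycielskian G = record
  { size = suc (size G + size G)
  ; Adj  = λ a b → MAdj G (classify a) (classify b) }

-- Write u i, u′ i (i < n) and v* for the vertices of M(P n).
-- Lower bound: take u i for i ≡ 2 (mod 4) and for i ≡ 0 (mod 4) with i + 1 < n, and u′ i for i ≢ 1 (mod 4).
-- No two chosen u i are adjacent and each has a neighbour u′ (i ± 1) outside the set, so vertices at distance
-- at most 3 along the path see each other directly, and all other pairs see each other through v*.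
-- Upper bound: read a mutual-visibility set S column by column (whether u j ∈ S, whether u′ j ∈ S). Two
-- vertices of S at most six columns apart have only a few shortest paths, so their visibility imposes explicit
-- conditions on the columns in between. A table of values on windows of six columns, computed offline and
-- checked here by evaluation, is a potential for these conditions: a column of weight w is admissible only
-- if 4 w ≤ 5 + (change of value). Summing along the path gives 4 |S| ≤ 5 n + 1.

module Submission where

open import Defs
open import Data.Nat using (ℕ; zero; suc; _+_; _≤_; _<_; _⊓_; _⊔_; ∣_-_∣; z≤n; s≤s; _/_; _*_; _≤ᵇ_)
open import Data.Nat.Properties
  using ( ≤-refl; ≤-trans; n≤1+n; <⇒≱; _<?_; ≤-<-trans; _≟_; +-suc; +-identityʳ; ≤ᵇ⇒≤; +-mono-≤
        ; +-monoʳ-≤; +-monoˡ-<; +-cancelʳ-≤; module ≤-Reasoning; m≤n+m; +-assoc; +-comm; *-comm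
        ; ∣-∣-comm; ∣-∣-triangle; ∣n-n∣≡0; ∣m-m+n∣≡n; ⊓-monoˡ-≤; ⊓-monoʳ-≤; ⊔-monoʳ-≤; ⊓-glb; m≤m⊔n
        ; m≤n⊔m; m⊓n≤m )
open import Data.Nat.DivMod using (m/n≡1+[m∸n]/n; m*n/n≡m; /-monoˡ-≤; /-congˡ; +-distrib-/-∣ˡ)
open import Data.Nat.Divisibility using (m∣m*n)
open import Data.Nat.Solver using (module +-*-Solver)
open import Data.Bool using (Bool; true; false; _∧_; _∨_; not; T)
open import Data.Unit using (⊤; tt)
open import Data.Empty using (⊥-elim; ⊥)
open import Data.Maybe using (Maybe; just; nothing)
open import Data.Product using (_×_; _,_; proj₁; proj₂; Σ)
open import Data.Sum using (_⊎_; inj₁; inj₂)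
open import Data.List using (List; []; _∷_)
open import Data.List.Relation.Unary.All using (All; []; _∷_)
open import Data.Fin using (Fin; toℕ; fromℕ<; _↑ˡ_; _↑ʳ_; splitAt)
open import Data.Fin.Properties
  using ( toℕ<n; toℕ-fromℕ<; fromℕ<-toℕ; splitAt-↑ˡ; splitAt-↑ʳ; splitAt⁻¹-↑ˡ; splitAt⁻¹-↑ʳ )
open import Data.Fin.Subset using (Subset; _∈_; _∉_; ∣_∣)
open import Data.Vec using (Vec; []; _∷_; _++_; lookup)
open import Data.Vec.Properties using (lookup-++ˡ; lookup-++ʳ; lookup⇒[]=; []=⇒lookup)
open import Relation.Nullary using (¬_; yes; no)
open import Relation.Binary.PropositionalEquality
  using ( _≡_; refl; sym; trans; cong; subst; subst₂; _≢_; cong₂; module ≡-Reasoning )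
import Data.List.Relation.Unary.All as All
import Data.Vec as Vec
open +-*-Solver using (solve; _:+_; _:*_; _:=_; con)

-- The Mycielskian of the one-sided infinite path; M(P n) is its subgraph on the indices below n.
data Vtx : Set where
  v*   : Vtx
  u u′ : ℕ → Vtx

infix 4 _~_

data _~_ : Vtx → Vtx → Set where
  uu+  : ∀ {i} → u i ~ u (suc i)
  uu-  : ∀ {i} → u (suc i) ~ u i
  uu′+ : ∀ {i} → u i ~ u′ (suc i)
  uu′- : ∀ {i} → u (suc i) ~ u′ i
  u′u+ : ∀ {i} → u′ i ~ u (suc i)
  u′u- : ∀ {i} → u′ (suc i) ~ u i
  u′v* : ∀ {i} → u′ i ~ v*
  v*u′ : ∀ {i} → v* ~ u′ i

~-sym : ∀ {x y} → x ~ y → y ~ x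
~-sym uu+  = uu-
~-sym uu-  = uu+
~-sym uu′+ = u′u-
~-sym uu′- = u′u+
~-sym u′u+ = uu′-
~-sym u′u- = uu′+
~-sym u′v* = v*u′
~-sym v*u′ = u′v*

infixr 5 _∷_

data Walk∞ : Vtx → Vtx → ℕ → Set where
  []  : ∀ {x} → Walk∞ x x 0
  _∷_ : ∀ {x y z k} → x ~ y → Walk∞ y z k → Walk∞ x z (suc k)

initVerts∞ : ∀ {x y k} → Walk∞ x y k → List Vtx
initVerts∞ []            = []
initVerts∞ (_∷_ {x} _ p) = x ∷ initVerts∞ p

inner∞ : ∀ {x y k} → Walk∞ x y k → List Vtx
inner∞ []      = []
inner∞ (_ ∷ p) = initVerts∞ p

_∷ʳ_ : ∀ {x y z k} → Walk∞ x y k → y ~ z → Walk∞ x z (suc k)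
[]      ∷ʳ e = e ∷ []
(e′ ∷ p) ∷ʳ e = e′ ∷ (p ∷ʳ e)

reverse∞ : ∀ {x y k} → Walk∞ x y k → Walk∞ y x k
reverse∞ []      = []
reverse∞ (e ∷ p) = reverse∞ p ∷ʳ ~-sym e

potential-bound : (f : Vtx → ℕ) → (∀ {x y} → x ~ y → f y ≤ suc (f x)) →
                  ∀ {x y k} → Walk∞ x y k → f y ≤ k + f x
potential-bound f lip []                         = ≤-refl
potential-bound f lip {x} {y} (_∷_ {y = x₁} {k = k} e p) = begin
  f y          ≤⟨ potential-bound f lip p ⟩
  k + f x₁     ≤⟨ +-monoʳ-≤ k (lip e) ⟩
  k + suc (f x) ≡⟨ +-suc k (f x) ⟩
  suc k + f x  ∎
  where open ≤-Reasoning

∣n-1+n∣≡1 : ∀ k → ∣ k - suc k ∣ ≡ 1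
∣n-1+n∣≡1 zero    = refl
∣n-1+n∣≡1 (suc k) = ∣n-1+n∣≡1 k

∣m-1+n∣≤1+∣m-n∣ : ∀ m n → ∣ m - suc n ∣ ≤ suc ∣ m - n ∣
∣m-1+n∣≤1+∣m-n∣ m n = begin
  ∣ m - suc n ∣            ≤⟨ ∣-∣-triangle m n (suc n) ⟩
  ∣ m - n ∣ + ∣ n - suc n ∣ ≡⟨ cong (∣ m - n ∣ +_) (∣n-1+n∣≡1 n) ⟩
  ∣ m - n ∣ + 1            ≡⟨ +-comm ∣ m - n ∣ 1 ⟩
  suc ∣ m - n ∣            ∎
  where open ≤-Reasoning

∣m-n∣≤1+∣m-1+n∣ : ∀ m n → ∣ m - n ∣ ≤ suc ∣ m - suc n ∣
∣m-n∣≤1+∣m-1+n∣ m n = begin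
  ∣ m - n ∣                ≤⟨ ∣-∣-triangle m (suc n) n ⟩
  ∣ m - suc n ∣ + ∣ suc n - n ∣ ≡⟨ cong (∣ m - suc n ∣ +_) (trans (∣-∣-comm (suc n) n) (∣n-1+n∣≡1 n)) ⟩
  ∣ m - suc n ∣ + 1        ≡⟨ +-comm ∣ m - suc n ∣ 1 ⟩
  suc ∣ m - suc n ∣        ∎
  where open ≤-Reasoning

clampᵤ clampᵤ′ : ℕ → ℕ
clampᵤ  d = 4 ⊓ d
clampᵤ′ d = 3 ⊓ (1 ⊔ d)

-- 1-Lipschitz along edges and zero at u i, hence a lower bound for the distance from u i.
dist≥ : ℕ → Vtx → ℕ
dist≥ i v*     = 2
dist≥ i (u k)  = clampᵤ ∣ i - k ∣
dist≥ i (u′ k) = clampᵤ′ ∣ i - k ∣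

clamp-step : ∀ {d d′} → d′ ≤ suc d → clampᵤ d′ ≤ suc (3 ⊓ d) × clampᵤ′ d′ ≤ suc (3 ⊓ d)
clamp-step {d} {d′} le =
  ⊓-monoʳ-≤ 4 le ,
  ≤-trans (⊓-monoʳ-≤ 3 (⊔-monoʳ-≤ 1 le)) (s≤s (⊓-monoˡ-≤ d (s≤s (s≤s z≤n))))

clamp-floor : ∀ d → 3 ⊓ d ≤ clampᵤ d × 3 ⊓ d ≤ clampᵤ′ d
clamp-floor d = ⊓-monoˡ-≤ d (s≤s (s≤s (s≤s z≤n))) , ⊓-monoʳ-≤ 3 (m≤n⊔m 1 d)

dist≥-lipschitz : ∀ i {x y} → x ~ y → dist≥ i y ≤ suc (dist≥ i x)
dist≥-lipschitz i (uu+ {k})  = ≤-trans (proj₁ (clamp-step (∣m-1+n∣≤1+∣m-n∣ i k))) (s≤s (proj₁ (clamp-floor _)))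
dist≥-lipschitz i (uu- {k})  = ≤-trans (proj₁ (clamp-step (∣m-n∣≤1+∣m-1+n∣ i k))) (s≤s (proj₁ (clamp-floor _)))
dist≥-lipschitz i (uu′+ {k}) = ≤-trans (proj₂ (clamp-step (∣m-1+n∣≤1+∣m-n∣ i k))) (s≤s (proj₁ (clamp-floor _)))
dist≥-lipschitz i (uu′- {k}) = ≤-trans (proj₂ (clamp-step (∣m-n∣≤1+∣m-1+n∣ i k))) (s≤s (proj₁ (clamp-floor _)))
dist≥-lipschitz i (u′u+ {k}) = ≤-trans (proj₁ (clamp-step (∣m-1+n∣≤1+∣m-n∣ i k))) (s≤s (proj₂ (clamp-floor _)))
dist≥-lipschitz i (u′u- {k}) = ≤-trans (proj₁ (clamp-step (∣m-n∣≤1+∣m-1+n∣ i k))) (s≤s (proj₂ (clamp-floor _)))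
dist≥-lipschitz i (u′v* {k}) = s≤s (⊓-glb (s≤s z≤n) (m≤m⊔n 1 ∣ i - k ∣))
dist≥-lipschitz i (v*u′ {k}) = ≤-trans (m⊓n≤m 3 (1 ⊔ ∣ i - k ∣)) (s≤s (s≤s (s≤s z≤n)))

dist≥-sound : ∀ {i y k} → Walk∞ (u i) y k → dist≥ i y ≤ k
dist≥-sound {i} {y} {k} p =
  subst (dist≥ i y ≤_) (trans (cong (λ d → k + clampᵤ d) (∣n-n∣≡0 i)) (+-identityʳ k))
        (potential-bound (dist≥ i) (dist≥-lipschitz i) p)

∣m-n+m∣≡n : ∀ m n → ∣ m - n + m ∣ ≡ n
∣m-n+m∣≡n m n = trans (cong (λ x → ∣ m - x ∣) (+-comm n m)) (∣m-m+n∣≡n m n)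

∣n+m-m∣≡n : ∀ m n → ∣ n + m - m ∣ ≡ n
∣n+m-m∣≡n m n = trans (∣-∣-comm (n + m) m) (∣m-n+m∣≡n m n)

dist-uuʳ : ∀ {i d k} → Walk∞ (u i) (u (d + i)) k → clampᵤ d ≤ k
dist-uuʳ {i} {d} p = subst (λ e → clampᵤ e ≤ _) (∣m-n+m∣≡n i d) (dist≥-sound p)

dist-uuˡ : ∀ {j d k} → Walk∞ (u (d + j)) (u j) k → clampᵤ d ≤ k
dist-uuˡ {j} {d} p = subst (λ e → clampᵤ e ≤ _) (∣n+m-m∣≡n j d) (dist≥-sound p)

dist-uu′ʳ : ∀ {i d k} → Walk∞ (u i) (u′ (d + i)) k → clampᵤ′ d ≤ k
dist-uu′ʳ {i} {d} p = subst (λ e → clampᵤ′ e ≤ _) (∣m-n+m∣≡n i d) (dist≥-sound p)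

dist-uu′ˡ : ∀ {j d k} → Walk∞ (u (d + j)) (u′ j) k → clampᵤ′ d ≤ k
dist-uu′ˡ {j} {d} p = subst (λ e → clampᵤ′ e ≤ _) (∣n+m-m∣≡n j d) (dist≥-sound p)

dist-uu′ : ∀ {i k} → Walk∞ (u i) (u′ i) k → 2 ≤ k
dist-uu′ (_ ∷ (_ ∷ _)) = s≤s (s≤s z≤n)
dist-uu′ (() ∷ [])

dist-u′u′ : ∀ {i j k} → ¬ i ≡ j → Walk∞ (u′ i) (u′ j) k → 2 ≤ k
dist-u′u′ i≢j []            = ⊥-elim (i≢j refl)
dist-u′u′ i≢j (() ∷ [])
dist-u′u′ i≢j (_ ∷ (_ ∷ _)) = s≤s (s≤s z≤n)

data Apart : ℕ → Set where
  apart1 : Apart 1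
  apart3 : Apart 3
  apart4 : Apart 4
  apart5 : Apart 5
  apart6 : Apart 6

out-of-reach : ∀ {c k} → 3 ≤ c → c ≤ k → ¬ k ≤ 2
out-of-reach 3≤c c≤k k≤2 = <⇒≱ (s≤s k≤2) (≤-trans 3≤c c≤k)

-- walks-XYdʳ (ˡ): the possible interiors of a walk of bounded length from an X-vertex to a Y-vertex d places
-- to its right (left).
module ShortWalks {F : Vtx → Set} where

  ShortWalk : Vtx → Vtx → ℕ → Set
  ShortWalk a b d = Σ ℕ λ k → k ≤ d × Σ (Walk∞ a b k) λ p → All F (inner∞ p)

  walks-uu2 : ∀ {i} → ShortWalk (u i) (u (2 + i)) 2 → F (u (1 + i)) ⊎ F (u′ (1 + i))
  walks-uu2 (_ , s≤s (s≤s z≤n) , uu+ ∷ uu+ ∷ [] , f ∷ []) = inj₁ f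
  walks-uu2 (_ , s≤s (s≤s z≤n) , uu′+ ∷ u′u+ ∷ [] , f ∷ []) = inj₂ f

  walks-u′u2 : ∀ {i} → ShortWalk (u′ i) (u (2 + i)) 2 → F (u (1 + i))
  walks-u′u2 (_ , s≤s (s≤s z≤n) , u′u+ ∷ uu+ ∷ [] , f ∷ []) = f

  walks-uu′2ʳ : ∀ {i} → ShortWalk (u i) (u′ (2 + i)) 2 → F (u (1 + i))
  walks-uu′2ʳ (_ , s≤s (s≤s z≤n) , uu+ ∷ uu′+ ∷ [] , f ∷ []) = f

  walks-uu′2ˡ : ∀ {i} → ShortWalk (u (2 + i)) (u′ i) 2 → F (u (1 + i))
  walks-uu′2ˡ (_ , s≤s (s≤s z≤n) , uu- ∷ uu′- ∷ [] , f ∷ []) = f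

  walks-u′u′2ʳ : ∀ {i} → ShortWalk (u′ i) (u′ (2 + i)) 2 → F (u (1 + i)) ⊎ F v*
  walks-u′u′2ʳ (_ , s≤s (s≤s z≤n) , u′u+ ∷ uu′+ ∷ [] , f ∷ []) = inj₁ f
  walks-u′u′2ʳ (_ , s≤s (s≤s z≤n) , u′v* ∷ v*u′ ∷ [] , f ∷ []) = inj₂ f

  walks-u′u′2ˡ : ∀ {i} → ShortWalk (u′ (2 + i)) (u′ i) 2 → F (u (1 + i)) ⊎ F v*
  walks-u′u′2ˡ (_ , s≤s (s≤s z≤n) , u′u- ∷ uu′- ∷ [] , f ∷ []) = inj₁ f
  walks-u′u′2ˡ (_ , s≤s (s≤s z≤n) , u′v* ∷ v*u′ ∷ [] , f ∷ []) = inj₂ f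

  walks-u′u′ʳ : ∀ {i d} → Apart d → ShortWalk (u′ i) (u′ (d + i)) 2 → F v*
  walks-u′u′ʳ apart1 (_ , s≤s (s≤s z≤n) , u′v* ∷ v*u′ ∷ [] , f ∷ []) = f
  walks-u′u′ʳ apart3 (_ , s≤s (s≤s z≤n) , u′v* ∷ v*u′ ∷ [] , f ∷ []) = f
  walks-u′u′ʳ apart4 (_ , s≤s (s≤s z≤n) , u′v* ∷ v*u′ ∷ [] , f ∷ []) = f
  walks-u′u′ʳ apart5 (_ , s≤s (s≤s z≤n) , u′v* ∷ v*u′ ∷ [] , f ∷ []) = f
  walks-u′u′ʳ apart6 (_ , s≤s (s≤s z≤n) , u′v* ∷ v*u′ ∷ [] , f ∷ []) = f

  walks-u′u′ˡ : ∀ {i d} → Apart d → ShortWalk (u′ (d + i)) (u′ i) 2 → F v*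
  walks-u′u′ˡ apart1 (_ , s≤s (s≤s z≤n) , u′v* ∷ v*u′ ∷ [] , f ∷ []) = f
  walks-u′u′ˡ apart3 (_ , s≤s (s≤s z≤n) , u′v* ∷ v*u′ ∷ [] , f ∷ []) = f
  walks-u′u′ˡ apart4 (_ , s≤s (s≤s z≤n) , u′v* ∷ v*u′ ∷ [] , f ∷ []) = f
  walks-u′u′ˡ apart5 (_ , s≤s (s≤s z≤n) , u′v* ∷ v*u′ ∷ [] , f ∷ []) = f
  walks-u′u′ˡ apart6 (_ , s≤s (s≤s z≤n) , u′v* ∷ v*u′ ∷ [] , f ∷ []) = f

  walks-uu3 : ∀ {i} → ShortWalk (u i) (u (3 + i)) 3 →
              (F (u (1 + i)) × F (u (2 + i))) ⊎ (F (u′ (1 + i)) × F (u (2 + i))) ⊎ (F (u (1 + i)) × F (u′ (2 + i)))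
  walks-uu3 (_ , s≤s k≤2 , uu+ ∷ p@(_ ∷ _) , f ∷ fs) with walks-uu2 (_ , k≤2 , p , fs)
  ... | inj₁ f′ = inj₁ (f , f′)
  ... | inj₂ f′ = inj₂ (inj₂ (f , f′))
  walks-uu3 (_ , s≤s k≤2 , uu′+ ∷ p@(_ ∷ _) , f ∷ fs) = inj₂ (inj₁ (f , walks-u′u2 (_ , k≤2 , p , fs)))
  walks-uu3 (_ , s≤s k≤2 , uu- ∷ p , _) = ⊥-elim (out-of-reach (n≤1+n 3) (dist-uuʳ {d = 4} p) k≤2)
  walks-uu3 (_ , s≤s k≤2 , uu′- ∷ p , _) = ⊥-elim (out-of-reach ≤-refl (dist-uu′ˡ {d = 4} (reverse∞ p)) k≤2)

  walks-uu′3ʳ : ∀ {i} → ShortWalk (u i) (u′ (3 + i)) 3 →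
                (F (u (1 + i)) × F (u (2 + i))) ⊎ (F (u′ (1 + i)) × F (u (2 + i))) ⊎ (F (u′ (1 + i)) × F v*) ⊎
                (Σ ℕ λ j → suc j ≡ i × F (u′ j) × F v*)
  walks-uu′3ʳ (_ , s≤s k≤2 , uu+ ∷ p@(_ ∷ _) , f ∷ fs) = inj₁ (f , walks-uu′2ʳ (_ , k≤2 , p , fs))
  walks-uu′3ʳ (_ , s≤s k≤2 , uu′+ ∷ p@(_ ∷ _) , f ∷ fs) with walks-u′u′2ʳ (_ , k≤2 , p , fs)
  ... | inj₁ f′ = inj₂ (inj₁ (f , f′))
  ... | inj₂ f′ = inj₂ (inj₂ (inj₁ (f , f′)))
  walks-uu′3ʳ (_ , s≤s k≤2 , uu′- ∷ p@(_ ∷ _) , f ∷ fs) =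
    inj₂ (inj₂ (inj₂ (_ , refl , f , walks-u′u′ʳ apart4 (_ , k≤2 , p , fs))))
  walks-uu′3ʳ (_ , s≤s k≤2 , uu- ∷ p , _) = ⊥-elim (out-of-reach ≤-refl (dist-uu′ʳ {d = 4} p) k≤2)

  walks-uu′3ˡ : ∀ {i} → ShortWalk (u (3 + i)) (u′ i) 3 →
                (F (u (2 + i)) × F (u (1 + i))) ⊎ (F (u′ (2 + i)) × F (u (1 + i))) ⊎ (F (u′ (2 + i)) × F v*) ⊎
                (F (u′ (4 + i)) × F v*)
  walks-uu′3ˡ (_ , s≤s k≤2 , uu- ∷ p@(_ ∷ _) , f ∷ fs) = inj₁ (f , walks-uu′2ˡ (_ , k≤2 , p , fs))
  walks-uu′3ˡ (_ , s≤s k≤2 , uu′- ∷ p@(_ ∷ _) , f ∷ fs) with walks-u′u′2ˡ (_ , k≤2 , p , fs)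
  ... | inj₁ f′ = inj₂ (inj₁ (f , f′))
  ... | inj₂ f′ = inj₂ (inj₂ (inj₁ (f , f′)))
  walks-uu′3ˡ (_ , s≤s k≤2 , uu′+ ∷ p@(_ ∷ _) , f ∷ fs) = inj₂ (inj₂ (inj₂ (f , walks-u′u′ˡ apart4 (_ , k≤2 , p , fs))))
  walks-uu′3ˡ (_ , s≤s k≤2 , uu+ ∷ p , _) = ⊥-elim (out-of-reach ≤-refl (dist-uu′ˡ {d = 4} p) k≤2)

  walks-uu′4ʳ : ∀ {i} → ShortWalk (u i) (u′ (4 + i)) 3 →
                (F (u′ (1 + i)) × F v*) ⊎ (Σ ℕ λ j → suc j ≡ i × F (u′ j) × F v*)
  walks-uu′4ʳ (_ , s≤s k≤2 , uu′+ ∷ p@(_ ∷ _) , f ∷ fs) = inj₁ (f , walks-u′u′ʳ apart3 (_ , k≤2 , p , fs))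
  walks-uu′4ʳ (_ , s≤s k≤2 , uu′- ∷ p@(_ ∷ _) , f ∷ fs) = inj₂ (_ , refl , f , walks-u′u′ʳ apart5 (_ , k≤2 , p , fs))
  walks-uu′4ʳ (_ , s≤s k≤2 , uu+ ∷ p , _) = ⊥-elim (out-of-reach ≤-refl (dist-uu′ʳ {d = 3} p) k≤2)
  walks-uu′4ʳ (_ , s≤s k≤2 , uu- ∷ p , _) = ⊥-elim (out-of-reach ≤-refl (dist-uu′ʳ {d = 5} p) k≤2)

  walks-uu′5ʳ : ∀ {i} → ShortWalk (u i) (u′ (5 + i)) 3 →
                (F (u′ (1 + i)) × F v*) ⊎ (Σ ℕ λ j → suc j ≡ i × F (u′ j) × F v*)
  walks-uu′5ʳ (_ , s≤s k≤2 , uu′+ ∷ p@(_ ∷ _) , f ∷ fs) = inj₁ (f , walks-u′u′ʳ apart4 (_ , k≤2 , p , fs))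
  walks-uu′5ʳ (_ , s≤s k≤2 , uu′- ∷ p@(_ ∷ _) , f ∷ fs) = inj₂ (_ , refl , f , walks-u′u′ʳ apart6 (_ , k≤2 , p , fs))
  walks-uu′5ʳ (_ , s≤s k≤2 , uu+ ∷ p , _) = ⊥-elim (out-of-reach ≤-refl (dist-uu′ʳ {d = 4} p) k≤2)
  walks-uu′5ʳ (_ , s≤s k≤2 , uu- ∷ p , _) = ⊥-elim (out-of-reach ≤-refl (dist-uu′ʳ {d = 6} p) k≤2)

  walks-uu′4ˡ : ∀ {i} → ShortWalk (u (4 + i)) (u′ i) 3 →
                (F (u′ (5 + i)) × F v*) ⊎ (F (u′ (3 + i)) × F v*)
  walks-uu′4ˡ (_ , s≤s k≤2 , uu′+ ∷ p@(_ ∷ _) , f ∷ fs) = inj₁ (f , walks-u′u′ˡ apart5 (_ , k≤2 , p , fs))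
  walks-uu′4ˡ (_ , s≤s k≤2 , uu′- ∷ p@(_ ∷ _) , f ∷ fs) = inj₂ (f , walks-u′u′ˡ apart3 (_ , k≤2 , p , fs))
  walks-uu′4ˡ (_ , s≤s k≤2 , uu+ ∷ p , _) = ⊥-elim (out-of-reach ≤-refl (dist-uu′ˡ {d = 5} p) k≤2)
  walks-uu′4ˡ (_ , s≤s k≤2 , uu- ∷ p , _) = ⊥-elim (out-of-reach ≤-refl (dist-uu′ˡ {d = 3} p) k≤2)

  walks-uu′5ˡ : ∀ {i} → ShortWalk (u (5 + i)) (u′ i) 3 →
                (F (u′ (6 + i)) × F v*) ⊎ (F (u′ (4 + i)) × F v*)
  walks-uu′5ˡ (_ , s≤s k≤2 , uu′+ ∷ p@(_ ∷ _) , f ∷ fs) = inj₁ (f , walks-u′u′ˡ apart6 (_ , k≤2 , p , fs))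
  walks-uu′5ˡ (_ , s≤s k≤2 , uu′- ∷ p@(_ ∷ _) , f ∷ fs) = inj₂ (f , walks-u′u′ˡ apart4 (_ , k≤2 , p , fs))
  walks-uu′5ˡ (_ , s≤s k≤2 , uu+ ∷ p , _) = ⊥-elim (out-of-reach ≤-refl (dist-uu′ˡ {d = 6} p) k≤2)
  walks-uu′5ˡ (_ , s≤s k≤2 , uu- ∷ p , _) = ⊥-elim (out-of-reach ≤-refl (dist-uu′ˡ {d = 4} p) k≤2)

lookupℕ : ∀ {A : Set} {m} → Vec A m → ℕ → Maybe A
lookupℕ []       _       = nothing
lookupℕ (x ∷ xs) zero    = just x
lookupℕ (x ∷ xs) (suc k) = lookupℕ xs k

lookupℕ-toℕ : ∀ {A : Set} {m} (xs : Vec A m) (i : Fin m) → lookupℕ xs (toℕ i) ≡ just (lookup xs i)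
lookupℕ-toℕ (x ∷ xs) Fin.zero    = refl
lookupℕ-toℕ (x ∷ xs) (Fin.suc i) = lookupℕ-toℕ xs i

lookupℕ-just⇒< : ∀ {A : Set} {m} (xs : Vec A m) k {a} → lookupℕ xs k ≡ just a → k < m
lookupℕ-just⇒< (x ∷ xs) zero    _  = s≤s z≤n
lookupℕ-just⇒< (x ∷ xs) (suc k) eq = s≤s (lookupℕ-just⇒< xs k eq)

lookupℕ-< : ∀ {A : Set} {m} (xs : Vec A m) k → k < m → Σ A λ a → lookupℕ xs k ≡ just a
lookupℕ-< (x ∷ xs) zero    _         = x , refl
lookupℕ-< (x ∷ xs) (suc k) (s≤s k<m) = lookupℕ-< xs k k<m

lookupℕ-≥ : ∀ {A : Set} {m} (xs : Vec A m) k → m ≤ k → lookupℕ xs k ≡ nothing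
lookupℕ-≥ []       k       _         = refl
lookupℕ-≥ (x ∷ xs) (suc k) (s≤s m≤k) = lookupℕ-≥ xs k m≤k

m+n<o⇒n<o : ∀ m {n o} → m + n < o → n < o
m+n<o⇒n<o m {n} = ≤-<-trans (m≤n+m n m)

m+[6+n]≡6+[m+n] : ∀ m n → m + (6 + n) ≡ 6 + (m + n)
m+[6+n]≡6+[m+n] m n = trans (sym (+-assoc m 6 n)) (cong (_+ n) (+-comm m 6))

just-not-true⇒just-false : ∀ {mb : Maybe Bool} {b} → mb ≡ just b → mb ≢ just true → mb ≡ just false
just-not-true⇒just-false {b = false} eq _  = eq
just-not-true⇒just-false {b = true}  eq ne = ⊥-elim (ne eq)

just-injective : ∀ {A : Set} {a b : A} → just a ≡ just b → a ≡ b
just-injective refl = refl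

module Bridge (n : ℕ) where

  M : Graph
  M = Mycielskian (Path n)

  projectKind : MKind n → Vtx
  projectKind star     = v*
  projectKind (orig i) = u (toℕ i)
  projectKind (copy i) = u′ (toℕ i)

  project : Fin (size M) → Vtx
  project v = projectKind (classify v)

  project-adj : ∀ a b → MAdj (Path n) a b → projectKind a ~ projectKind b
  project-adj (orig i) (orig j) (inj₁ eq) rewrite eq = uu+
  project-adj (orig i) (orig j) (inj₂ eq) rewrite eq = uu-
  project-adj (orig i) (copy j) (inj₁ eq) rewrite eq = uu′+
  project-adj (orig i) (copy j) (inj₂ eq) rewrite eq = uu′-
  project-adj (copy i) (orig j) (inj₁ eq) rewrite eq = u′u+
  project-adj (copy i) (orig j) (inj₂ eq) rewrite eq = u′u-
  project-adj (copy i) star     _ = u′v*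
  project-adj star     (copy j) _ = v*u′

  projectWalk : ∀ {x y k} → Walk M x y k → Walk∞ (project x) (project y) k
  projectWalk []                  = []
  projectWalk (_∷_ {x} {y} e p) = project-adj (classify x) (classify y) e ∷ projectWalk p

  module _ {P : Fin (size M) → Set} {Q : Vtx → Set} (P⇒Q : ∀ v → P v → Q (project v)) where

    projectWalk-initVerts : ∀ {x y k} (p : Walk M x y k) → All P (initVerts p) → All Q (initVerts∞ (projectWalk p))
    projectWalk-initVerts []      []       = []
    projectWalk-initVerts (_ ∷ p) (px ∷ ps) = P⇒Q _ px ∷ projectWalk-initVerts p ps

    projectWalk-inner : ∀ {x y k} (p : Walk M x y k) → All P (inner p) → All Q (inner∞ (projectWalk p))
    projectWalk-inner []      []  = []
    projectWalk-inner (_ ∷ p) ps = projectWalk-initVerts p ps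

  InRange : Vtx → Set
  InRange v*     = ⊤
  InRange (u m)  = m < n
  InRange (u′ m) = m < n

  -- Out-of-range vertices are sent to the junk value v*.
  embed : Vtx → Fin (size M)
  embed v*     = Fin.zero
  embed (u m) with m <? n
  ... | yes m<n = Fin.suc (fromℕ< m<n ↑ˡ n)
  ... | no _    = Fin.zero
  embed (u′ m) with m <? n
  ... | yes m<n = Fin.suc (n ↑ʳ fromℕ< m<n)
  ... | no _    = Fin.zero

  embedKind : ∀ x → InRange x → MKind n
  embedKind v*     _   = star
  embedKind (u m)  m<n = orig (fromℕ< m<n)
  embedKind (u′ m) m<n = copy (fromℕ< m<n)

  classify-embed : ∀ x (r : InRange x) → classify (embed x) ≡ embedKind x r
  classify-embed v*     _ = refl
  classify-embed (u m)  r with m <? n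
  ... | yes m<n rewrite splitAt-↑ˡ n (fromℕ< m<n) n = refl
  ... | no m≮n  = ⊥-elim (m≮n r)
  classify-embed (u′ m) r with m <? n
  ... | yes m<n rewrite splitAt-↑ʳ n n (fromℕ< m<n) = refl
  ... | no m≮n  = ⊥-elim (m≮n r)

  project-embed : ∀ x (r : InRange x) → project (embed x) ≡ x
  project-embed v*     r = refl
  project-embed (u m)  r rewrite classify-embed (u m) r = cong u (toℕ-fromℕ< r)
  project-embed (u′ m) r rewrite classify-embed (u′ m) r = cong u′ (toℕ-fromℕ< r)

  embed-project : ∀ v → embed (project v) ≡ v
  embed-project Fin.zero = refl
  embed-project (Fin.suc w) with splitAt n w in eq
  ... | inj₁ i with toℕ i <? n
  ...   | yes i<n = cong Fin.suc (trans (cong (_↑ˡ n) (fromℕ<-toℕ i i<n)) (splitAt⁻¹-↑ˡ eq))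
  ...   | no i≮n  = ⊥-elim (i≮n (toℕ<n i))
  embed-project (Fin.suc w) | inj₂ i with toℕ i <? n
  ...   | yes i<n = cong Fin.suc (trans (cong (n ↑ʳ_) (fromℕ<-toℕ i i<n)) (splitAt⁻¹-↑ʳ eq))
  ...   | no i≮n  = ⊥-elim (i≮n (toℕ<n i))

  toℕ-fromℕ<-suc : ∀ {i} (r : i < n) (r′ : suc i < n) → toℕ (fromℕ< r′) ≡ suc (toℕ (fromℕ< r))
  toℕ-fromℕ<-suc r r′ = trans (toℕ-fromℕ< r′) (cong suc (sym (toℕ-fromℕ< r)))

  embedKind-adj : ∀ {x y} → x ~ y → (rx : InRange x) (ry : InRange y) → MAdj (Path n) (embedKind x rx) (embedKind y ry)
  embedKind-adj uu+  rx ry = inj₁ (toℕ-fromℕ<-suc rx ry)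
  embedKind-adj uu-  rx ry = inj₂ (toℕ-fromℕ<-suc ry rx)
  embedKind-adj uu′+ rx ry = inj₁ (toℕ-fromℕ<-suc rx ry)
  embedKind-adj uu′- rx ry = inj₂ (toℕ-fromℕ<-suc ry rx)
  embedKind-adj u′u+ rx ry = inj₁ (toℕ-fromℕ<-suc rx ry)
  embedKind-adj u′u- rx ry = inj₂ (toℕ-fromℕ<-suc ry rx)
  embedKind-adj u′v* rx ry = tt
  embedKind-adj v*u′ rx ry = tt

  embed-adj : ∀ {x y} → x ~ y → InRange x → InRange y → Adj M (embed x) (embed y)
  embed-adj {x} {y} e rx ry =
    subst₂ (MAdj (Path n)) (sym (classify-embed x rx)) (sym (classify-embed y ry)) (embedKind-adj e rx ry)

  Inside : ∀ {x y k} → Walk∞ x y k → Set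
  Inside {x} []      = InRange x
  Inside {x} (_ ∷ p) = InRange x × Inside p

  inside-head : ∀ {x y k} (p : Walk∞ x y k) → Inside p → InRange x
  inside-head []      r       = r
  inside-head (_ ∷ p) (r , _) = r

  inside-last : ∀ {x y k} (p : Walk∞ x y k) → Inside p → InRange y
  inside-last []      r        = r
  inside-last (_ ∷ p) (_ , rs) = inside-last p rs

  embedWalk : ∀ {x y k} (p : Walk∞ x y k) → Inside p → Walk M (embed x) (embed y) k
  embedWalk []      _        = []
  embedWalk (e ∷ p) (r , rs) = embed-adj e r (inside-head p rs) ∷ embedWalk p rs

  module _ {P : Fin (size M) → Set} where

    embedWalk-initVerts : ∀ {x y k} (p : Walk∞ x y k) (rs : Inside p) →
                          All (λ v → P (embed v)) (initVerts∞ p) → All P (initVerts (embedWalk p rs))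
    embedWalk-initVerts []      _        []        = []
    embedWalk-initVerts (_ ∷ p) (_ , rs) (px ∷ ps) = px ∷ embedWalk-initVerts p rs ps

    embedWalk-inner : ∀ {x y k} (p : Walk∞ x y k) (rs : Inside p) →
                      All (λ v → P (embed v)) (inner∞ p) → All P (inner (embedWalk p rs))
    embedWalk-inner []      _        []  = []
    embedWalk-inner (_ ∷ p) (_ , rs) ps = embedWalk-initVerts p rs ps

  module Membership (z : Bool) (xs ys : Vec Bool n) where

    S : Subset (size M)
    S = z ∷ (xs ++ ys)

    -- nothing for a vertex outside the range, otherwise its membership in S
    status : Vtx → Maybe Bool
    status v*     = just z
    status (u m)  = lookupℕ xs m
    status (u′ m) = lookupℕ ys m

    Member Free : Vtx → Set
    Member x = status x ≡ just true
    Free   x = status x ≡ just false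

    status-project : ∀ v → status (project v) ≡ just (lookup S v)
    status-project Fin.zero = refl
    status-project (Fin.suc w) with splitAt n w in eq
    ... | inj₁ i rewrite sym (splitAt⁻¹-↑ˡ eq) = trans (lookupℕ-toℕ xs i) (cong just (sym (lookup-++ˡ xs ys i)))
    ... | inj₂ i rewrite sym (splitAt⁻¹-↑ʳ eq) = trans (lookupℕ-toℕ ys i) (cong just (sym (lookup-++ʳ xs ys i)))

    status⇒InRange : ∀ x {b} → status x ≡ just b → InRange x
    status⇒InRange v*     _  = tt
    status⇒InRange (u m)  eq = lookupℕ-just⇒< xs m eq
    status⇒InRange (u′ m) eq = lookupℕ-just⇒< ys m eq

    status-embed : ∀ x → InRange x → status x ≡ just (lookup S (embed x))
    status-embed x r = trans (cong status (sym (project-embed x r))) (status-project (embed x))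

    Member⇒∈ : ∀ x → Member x → embed x ∈ S
    Member⇒∈ x eq = lookup⇒[]= (embed x) S (just-injective (trans (sym (status-embed x (status⇒InRange x eq))) eq))

    ∈⇒Member : ∀ v → v ∈ S → Member (project v)
    ∈⇒Member v v∈S = trans (status-project v) (cong just ([]=⇒lookup v∈S))

    Free⇒∉ : ∀ x → Free x → embed x ∉ S
    Free⇒∉ x eq x∈S with trans (sym (status-embed x (status⇒InRange x eq))) eq
    ... | lookup≡false rewrite []=⇒lookup x∈S with lookup≡false
    ... | ()

    ∉⇒Free : ∀ v → v ∉ S → Free (project v)
    ∉⇒Free v v∉S with lookup S v in eq
    ... | true  = ⊥-elim (v∉S (lookup⇒[]= v S eq))
    ... | false = trans (status-project v) (cong just eq)

    visible-by-walk : ∀ {a b d} (p : Walk∞ a b d) (rs : Inside p) → All Free (inner∞ p) →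
                      (∀ {k} → Walk∞ a b k → d ≤ k) → Visible M S (embed a) (embed b)
    visible-by-walk {a} {b} {d} p rs free shortest =
      d , embedWalk p rs , shortest′ , embedWalk-inner p rs (All.map (λ {x} → Free⇒∉ x) free)
      where
        shortest′ : IsShortest (embedWalk p rs)
        shortest′ k q with projectWalk q
        ... | q′ rewrite project-embed a (inside-head p rs) | project-embed b (inside-last p rs) = shortest q′

    shortcut : MutualVisibility M S → ∀ {a b d} → Member a → Member b → (p : Walk∞ a b d) → Inside p →
               Σ ℕ λ k → k ≤ d × Σ (Walk∞ a b k) (λ q → All Free (inner∞ q))
    shortcut mv {a} {b} {d} ma mb p rs with mv (embed a) (embed b) (Member⇒∈ a ma) (Member⇒∈ b mb)
    ... | k , q , shortest , avoids with projectWalk q | projectWalk-inner ∉⇒Free q avoids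
    ... | q′ | free rewrite project-embed a (status⇒InRange a ma) | project-embed b (status⇒InRange b mb) =
      k , shortest d (embedWalk p rs) , q′ , free

bit : Bool → ℕ
bit true  = 1
bit false = 0

∣b∷p∣≡bit+∣p∣ : ∀ {m} b (p : Subset m) → ∣ b ∷ p ∣ ≡ bit b + ∣ p ∣
∣b∷p∣≡bit+∣p∣ true  p = refl
∣b∷p∣≡bit+∣p∣ false p = refl

∣p++q∣≡∣p∣+∣q∣ : ∀ {m k} (p : Subset m) (q : Subset k) → ∣ p ++ q ∣ ≡ ∣ p ∣ + ∣ q ∣
∣p++q∣≡∣p∣+∣q∣ []          q = refl
∣p++q∣≡∣p∣+∣q∣ (true ∷ p)  q = cong suc (∣p++q∣≡∣p∣+∣q∣ p q)
∣p++q∣≡∣p∣+∣q∣ (false ∷ p) q = ∣p++q∣≡∣p∣+∣q∣ p q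

uPattern u′Pattern : (n : ℕ) → Vec Bool n
uPattern (suc (suc (suc (suc n)))) = true ∷ false ∷ true ∷ false ∷ uPattern n
uPattern 0 = []
uPattern 1 = false ∷ []
uPattern 2 = true ∷ false ∷ []
uPattern 3 = true ∷ false ∷ true ∷ []
u′Pattern (suc (suc (suc (suc n)))) = true ∷ false ∷ true ∷ true ∷ u′Pattern n
u′Pattern 0 = []
u′Pattern 1 = true ∷ []
u′Pattern 2 = true ∷ false ∷ []
u′Pattern 3 = true ∷ false ∷ true ∷ []

uPattern-isolated : ∀ n m → lookupℕ (uPattern n) m ≡ just true → lookupℕ (uPattern n) (suc m) ≢ just true
uPattern-isolated (suc (suc (suc (suc n)))) (suc (suc (suc (suc m)))) = uPattern-isolated n m
uPattern-isolated (suc (suc (suc (suc n)))) 0 _ ()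
uPattern-isolated (suc (suc (suc (suc n)))) 1 ()
uPattern-isolated (suc (suc (suc (suc n)))) 2 _ ()
uPattern-isolated (suc (suc (suc (suc n)))) 3 ()
uPattern-isolated 1 0 ()
uPattern-isolated 2 0 _ ()
uPattern-isolated 2 1 ()
uPattern-isolated 3 0 _ ()
uPattern-isolated 3 1 ()
uPattern-isolated 3 2 _ ()

uPattern-exit : ∀ n m → lookupℕ (uPattern n) m ≡ just true →
                lookupℕ (u′Pattern n) (suc m) ≡ just false ⊎ Σ ℕ λ j → suc j ≡ m × lookupℕ (u′Pattern n) j ≡ just false
uPattern-exit (suc (suc (suc (suc n)))) (suc (suc (suc (suc m)))) h with uPattern-exit n m h
... | inj₁ free             = inj₁ free
... | inj₂ (j , refl , free) = inj₂ (4 + j , refl , free)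
uPattern-exit (suc (suc (suc (suc n)))) 0 _ = inj₁ refl
uPattern-exit (suc (suc (suc (suc n)))) 1 ()
uPattern-exit (suc (suc (suc (suc n)))) 2 _ = inj₂ (1 , refl , refl)
uPattern-exit (suc (suc (suc (suc n)))) 3 ()
uPattern-exit 1 0 ()
uPattern-exit 2 0 _ = inj₁ refl
uPattern-exit 2 1 ()
uPattern-exit 3 0 _ = inj₁ refl
uPattern-exit 3 1 ()
uPattern-exit 3 2 _ = inj₂ (1 , refl , refl)

data Offset : ℕ → ℕ → Set where
  right : ∀ d i → Offset i (d + i)
  left  : ∀ d j → Offset (suc d + j) j

offset : ∀ i j → Offset i j
offset zero    j       = subst (Offset 0) (+-identityʳ j) (right j 0)
offset (suc i) zero    = subst (λ m → Offset m 0) (cong suc (+-identityʳ i)) (left i 0)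
offset (suc i) (suc j) with offset i j
... | right d .i = subst (Offset (suc i)) (+-suc d i) (right d (suc i))
... | left d .j  = subst (λ m → Offset m (suc j)) (cong suc (+-suc d j)) (left d (suc j))

module LowerBound (n : ℕ) (1<n : 1 < n) where
  open Bridge n
  open Membership false (uPattern n) (u′Pattern n)

  next-free : ∀ {i} → Member (u i) → suc i < n → Free (u (suc i))
  next-free {i} mi lt = just-not-true⇒just-false (proj₂ (lookupℕ-< (uPattern n) (suc i) lt)) (uPattern-isolated n i mi)

  prev-free : ∀ {i} → Member (u (suc i)) → Free (u i)
  prev-free {i} mi =
    just-not-true⇒just-false (proj₂ (lookupℕ-< (uPattern n) i (m+n<o⇒n<o 1 (status⇒InRange (u (suc i)) mi))))
                             (λ mi′ → uPattern-isolated n i mi′ mi)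

  exit : ∀ {i} → Member (u i) → Σ ℕ λ h → u i ~ u′ h × Free (u′ h)
  exit {i} mi with uPattern-exit n i mi
  ... | inj₁ free              = suc i , uu′+ , free
  ... | inj₂ (j , refl , free) = j , uu′- , free

  range : ∀ x {b} → status x ≡ just b → InRange x
  range = status⇒InRange

  uu-via-v* : ∀ {i j} → Member (u i) → Member (u j) → (∀ {k} → Walk∞ (u i) (u j) k → 4 ≤ k) →
           Visible M S (embed (u i)) (embed (u j))
  uu-via-v* {i} {j} mi mj lb with exit mi | exit mj
  ... | h₁ , e₁ , f₁ | h₂ , e₂ , f₂ =
    visible-by-walk (e₁ ∷ u′v* ∷ v*u′ ∷ ~-sym e₂ ∷ [])
      (range (u i) mi , range (u′ h₁) f₁ , tt , range (u′ h₂) f₂ , range (u j) mj) (f₁ ∷ refl ∷ f₂ ∷ []) lb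

  visible-uu : ∀ {i j} → Member (u i) → Member (u j) → Visible M S (embed (u i)) (embed (u j))
  visible-uu {i} {j} mi mj with offset i j | range (u i) mi | range (u j) mj
  ... | right 0 .i | ri | _  = visible-by-walk {a = u i} [] ri [] (λ _ → z≤n)
  ... | right 1 .i | ri | rj = visible-by-walk (uu+ ∷ []) (ri , rj) [] dist-uuʳ
  ... | right 2 .i | ri | rj =
    visible-by-walk (uu+ ∷ uu+ ∷ []) (ri , m+n<o⇒n<o 1 rj , rj) (next-free mi (m+n<o⇒n<o 1 rj) ∷ []) dist-uuʳ
  ... | right 3 .i | ri | rj =
    visible-by-walk (uu+ ∷ uu+ ∷ uu+ ∷ []) (ri , m+n<o⇒n<o 2 rj , m+n<o⇒n<o 1 rj , rj)
      (next-free mi (m+n<o⇒n<o 2 rj) ∷ prev-free mj ∷ []) dist-uuʳ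
  ... | right (suc (suc (suc (suc d)))) .i | _ | _ = uu-via-v* mi mj dist-uuʳ
  ... | left 0 .j | ri | rj = visible-by-walk (uu- ∷ []) (ri , rj) [] dist-uuˡ
  ... | left 1 .j | ri | rj =
    visible-by-walk (uu- ∷ uu- ∷ []) (ri , m+n<o⇒n<o 1 ri , rj) (prev-free mi ∷ []) dist-uuˡ
  ... | left 2 .j | ri | rj =
    visible-by-walk (uu- ∷ uu- ∷ uu- ∷ []) (ri , m+n<o⇒n<o 1 ri , m+n<o⇒n<o 2 ri , rj)
      (prev-free mi ∷ next-free mj (m+n<o⇒n<o 2 ri) ∷ []) dist-uuˡ
  ... | left (suc (suc (suc d))) .j | _ | _ = uu-via-v* mi mj dist-uuˡ

  uu′-via-v* : ∀ {i j} → Member (u i) → Member (u′ j) → (∀ {k} → Walk∞ (u i) (u′ j) k → 3 ≤ k) →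
            Visible M S (embed (u i)) (embed (u′ j))
  uu′-via-v* {i} {j} mi mj lb with exit mi
  ... | h , e , f =
    visible-by-walk (e ∷ u′v* ∷ v*u′ ∷ []) (range (u i) mi , range (u′ h) f , tt , range (u′ j) mj) (f ∷ refl ∷ []) lb

  u′u-via-v* : ∀ {i j} → Member (u′ j) → Member (u i) → (∀ {k} → Walk∞ (u i) (u′ j) k → 3 ≤ k) →
            Visible M S (embed (u′ j)) (embed (u i))
  u′u-via-v* {i} {j} mj mi lb with exit mi
  ... | h , e , f =
    visible-by-walk (u′v* ∷ v*u′ ∷ ~-sym e ∷ []) (range (u′ j) mj , tt , range (u′ h) f , range (u i) mi)
      (refl ∷ f ∷ []) (λ q → lb (reverse∞ q))

  visible-uu′ : ∀ {i j} → Member (u i) → Member (u′ j) → Visible M S (embed (u i)) (embed (u′ j))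
  visible-uu′ {i} {j} mi mj with offset i j | range (u i) mi | range (u′ j) mj
  visible-uu′ {zero} mi mj | right 0 .0 | ri | rj =
    visible-by-walk (uu+ ∷ uu′- ∷ []) (ri , 1<n , rj) (next-free mi 1<n ∷ []) dist-uu′
  visible-uu′ {suc i} mi mj | right 0 .(suc i) | ri | rj =
    visible-by-walk (uu- ∷ uu′+ ∷ []) (ri , m+n<o⇒n<o 1 ri , rj) (prev-free mi ∷ []) dist-uu′
  ... | right 1 .i | ri | rj = visible-by-walk (uu′+ ∷ []) (ri , rj) [] dist-uu′ʳ
  ... | right 2 .i | ri | rj =
    visible-by-walk (uu+ ∷ uu′+ ∷ []) (ri , m+n<o⇒n<o 1 rj , rj) (next-free mi (m+n<o⇒n<o 1 rj) ∷ []) dist-uu′ʳ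
  ... | right (suc (suc (suc d))) .i | _ | _ = uu′-via-v* mi mj dist-uu′ʳ
  ... | left 0 .j | ri | rj = visible-by-walk (uu′- ∷ []) (ri , rj) [] dist-uu′ˡ
  ... | left 1 .j | ri | rj =
    visible-by-walk (uu- ∷ uu′- ∷ []) (ri , m+n<o⇒n<o 1 ri , rj) (prev-free mi ∷ []) dist-uu′ˡ
  ... | left (suc (suc d)) .j | _ | _ = uu′-via-v* mi mj dist-uu′ˡ

  visible-u′u : ∀ {i j} → Member (u′ j) → Member (u i) → Visible M S (embed (u′ j)) (embed (u i))
  visible-u′u {i} {j} mj mi with offset i j | range (u i) mi | range (u′ j) mj
  visible-u′u {zero} mj mi | right 0 .0 | ri | rj =
    visible-by-walk (u′u+ ∷ uu- ∷ []) (rj , 1<n , ri) (next-free mi 1<n ∷ []) (λ q → dist-uu′ (reverse∞ q))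
  visible-u′u {suc i} mj mi | right 0 .(suc i) | ri | rj =
    visible-by-walk (u′u- ∷ uu+ ∷ []) (rj , m+n<o⇒n<o 1 ri , ri) (prev-free mi ∷ []) (λ q → dist-uu′ (reverse∞ q))
  ... | right 1 .i | ri | rj = visible-by-walk (u′u- ∷ []) (rj , ri) [] (λ q → dist-uu′ʳ (reverse∞ q))
  ... | right 2 .i | ri | rj =
    visible-by-walk (u′u- ∷ uu- ∷ []) (rj , m+n<o⇒n<o 1 rj , ri) (next-free mi (m+n<o⇒n<o 1 rj) ∷ [])
      (λ q → dist-uu′ʳ (reverse∞ q))
  ... | right (suc (suc (suc d))) .i | _ | _ = u′u-via-v* mj mi dist-uu′ʳ
  ... | left 0 .j | ri | rj = visible-by-walk (u′u+ ∷ []) (rj , ri) [] (λ q → dist-uu′ˡ (reverse∞ q))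
  ... | left 1 .j | ri | rj =
    visible-by-walk (u′u+ ∷ uu+ ∷ []) (rj , m+n<o⇒n<o 1 ri , ri) (prev-free mi ∷ []) (λ q → dist-uu′ˡ (reverse∞ q))
  ... | left (suc (suc d)) .j | _ | _ = u′u-via-v* mj mi dist-uu′ˡ

  visible-u′u′ : ∀ {i j} → Member (u′ i) → Member (u′ j) → Visible M S (embed (u′ i)) (embed (u′ j))
  visible-u′u′ {i} {j} mi mj with i ≟ j
  ... | yes refl = visible-by-walk {a = u′ i} [] (range (u′ i) mi) [] (λ _ → z≤n)
  ... | no i≢j   =
    visible-by-walk (u′v* ∷ v*u′ ∷ []) (range (u′ i) mi , tt , range (u′ j) mj) (refl ∷ []) (dist-u′u′ i≢j)

  visible : ∀ a b → Member a → Member b → Visible M S (embed a) (embed b)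
  visible (u i)  (u j)  = visible-uu
  visible (u i)  (u′ j) = visible-uu′
  visible (u′ j) (u i)  = visible-u′u
  visible (u′ i) (u′ j) = visible-u′u′

  mutual-visibility : MutualVisibility M S
  mutual-visibility x y x∈S y∈S =
    subst₂ (Visible M S) (embed-project x) (embed-project y)
           (visible (project x) (project y) (∈⇒Member x x∈S) (∈⇒Member y y∈S))

∣pattern∣ : ∀ n → ∣ uPattern n ∣ + ∣ u′Pattern n ∣ ≡ n + suc n / 4
∣pattern∣ 0 = refl
∣pattern∣ 1 = refl
∣pattern∣ 2 = refl
∣pattern∣ 3 = refl
∣pattern∣ (suc (suc (suc (suc n)))) = begin
  2 + ∣ uPattern n ∣ + (3 + ∣ u′Pattern n ∣) ≡⟨ cong (2 +_) (+-suc³ ∣ uPattern n ∣ ∣ u′Pattern n ∣) ⟩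
  5 + (∣ uPattern n ∣ + ∣ u′Pattern n ∣)     ≡⟨ cong (5 +_) (∣pattern∣ n) ⟩
  5 + (n + suc n / 4)                        ≡⟨ cong (4 +_) (sym (+-suc n (suc n / 4))) ⟩
  4 + n + suc (suc n / 4)                    ≡⟨ cong (4 + n +_) (sym (m/n≡1+[m∸n]/n {5 + n} {4} (s≤s (s≤s (s≤s (s≤s z≤n)))))) ⟩
  4 + n + (5 + n) / 4                        ∎
  where
    open ≡-Reasoning
    +-suc³ : ∀ a b → a + (3 + b) ≡ 3 + (a + b)
    +-suc³ a b = trans (+-suc a _) (cong suc (trans (+-suc a _) (cong suc (+-suc a b))))

_⇒ᵇ_ : Bool → Bool → Bool
true  ⇒ᵇ b = b
false ⇒ᵇ _ = true

infixr 4 _&_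

_&_ : ∀ {a b} → T a → T b → T (a ∧ b)
_&_ {true} _ q = q

⇒ᵇ-true : ∀ a → T (a ⇒ᵇ true)
⇒ᵇ-true true  = tt
⇒ᵇ-true false = tt

∧-split : ∀ a {b} → T (a ∧ b) → T a × T b
∧-split true p = tt , p

∨-introˡ : ∀ {a} b → T a → T (a ∨ b)
∨-introˡ {true} _ _ = tt

∨-introʳ : ∀ a {b} → T b → T (a ∨ b)
∨-introʳ true  _ = tt
∨-introʳ false p = p

not-intro : ∀ {a} → (T a → ⊥) → T (not a)
not-intro {true}  ¬a = ¬a tt
not-intro {false} _  = tt

⇒ᵇ-intro : ∀ {a b} → (T a → T b) → T (a ⇒ᵇ b)
⇒ᵇ-intro {true}  f = f tt
⇒ᵇ-intro {false} _ = tt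

⇒ᵇ-elim : ∀ {a b} → T (a ⇒ᵇ b) → T a → T b
⇒ᵇ-elim {true} p _ = p

-- What a mutual-visibility set looks like at position j: void outside the range,
-- otherwise col x y where x says u j ∈ S and y says u′ j ∈ S.
data Column : Set where
  void : Column
  col  : Bool → Bool → Column

Real : Column → Set
Real void      = ⊥
Real (col _ _) = ⊤

uIn u′In uOut u′Out : Column → Bool
uIn   (col x _) = x
uIn   void      = false
u′In  (col _ y) = y
u′In  void      = false
uOut  (col x _) = not x
uOut  void      = false
u′Out (col _ y) = not y
u′Out void      = false

weight : Column → ℕ
weight (col x y) = bit x + bit y
weight void      = 0

isVoid : Column → ℕ
isVoid void      = 1
isVoid (col _ _) = 0

-- What visibility of two vertices of S in the end columns forces on the columns between them: uu3 for u j
-- and u (j + 3), uu′2, uu′3 and uu′far for u j and u′ (j ± 2), u′ (j ± 3) and u′ (j ± 4 or 5), u′u′ for two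
-- copies; z records v* ∈ S, and m is the column on the other side of the u-end.
uu3 : Column → Column → Column → Column → Bool
uu3 a b c d = (uIn a ∧ uIn d) ⇒ᵇ ((uOut b ∧ uOut c) ∨ (u′Out b ∧ uOut c) ∨ (uOut b ∧ u′Out c))

uu′2 : Column → Column → Column → Bool
uu′2 a b c = (uIn a ∧ u′In c) ⇒ᵇ uOut b

uu′3 : Bool → Column → Column → Column → Column → Column → Bool
uu′3 z m a b c d =
  (uIn a ∧ u′In d) ⇒ᵇ ((uOut b ∧ uOut c) ∨ (u′Out b ∧ uOut c) ∨ (u′Out b ∧ not z) ∨ (u′Out m ∧ not z))

uu′far : Bool → Column → Column → Column → Column → Bool
uu′far z m a b e = (uIn a ∧ u′In e) ⇒ᵇ (not z ∧ (u′Out b ∨ u′Out m))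

u′u′ : Bool → Column → Column → Bool
u′u′ z a e = z ⇒ᵇ not (u′In a ∧ u′In e)

window-ok : Bool → Column → Column → Column → Column → Column → Column → Column → Bool
window-ok z a0 a1 a2 a3 a4 a5 a6 =
  (uu3 a0 a1 a2 a3 ∧ uu3 a1 a2 a3 a4 ∧ uu3 a2 a3 a4 a5 ∧ uu3 a3 a4 a5 a6) ∧
  (uu′2 a0 a1 a2 ∧ uu′2 a1 a2 a3 ∧ uu′2 a2 a3 a4 ∧ uu′2 a3 a4 a5 ∧ uu′2 a4 a5 a6) ∧
  (uu′2 a2 a1 a0 ∧ uu′2 a3 a2 a1 ∧ uu′2 a4 a3 a2 ∧ uu′2 a5 a4 a3 ∧ uu′2 a6 a5 a4) ∧
  (uu′3 z a0 a1 a2 a3 a4 ∧ uu′3 z a1 a2 a3 a4 a5 ∧ uu′3 z a2 a3 a4 a5 a6) ∧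
  (uu′3 z a4 a3 a2 a1 a0 ∧ uu′3 z a5 a4 a3 a2 a1 ∧ uu′3 z a6 a5 a4 a3 a2) ∧
  (uu′far z a0 a1 a2 a5 ∧ uu′far z a1 a2 a3 a6 ∧ uu′far z a0 a1 a2 a6) ∧
  (uu′far z a5 a4 a3 a0 ∧ uu′far z a6 a5 a4 a1 ∧ uu′far z a6 a5 a4 a0) ∧
  (u′u′ z a0 a1 ∧ u′u′ z a1 a2 ∧ u′u′ z a2 a3 ∧ u′u′ z a3 a4 ∧ u′u′ z a4 a5 ∧ u′u′ z a5 a6) ∧
  (u′u′ z a0 a3 ∧ u′u′ z a1 a4 ∧ u′u′ z a2 a5 ∧ u′u′ z a3 a6) ∧
  (u′u′ z a0 a4 ∧ u′u′ z a1 a5 ∧ u′u′ z a2 a6) ∧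
  (u′u′ z a0 a5 ∧ u′u′ z a1 a6)

State : Set
State = Vec Column 6

allowed : Bool → State → Column → Bool
allowed z (a0 ∷ a1 ∷ a2 ∷ a3 ∷ a4 ∷ a5 ∷ []) c = window-ok z a0 a1 a2 a3 a4 a5 c

shift : State → Column → State
shift (_ ∷ a1 ∷ a2 ∷ a3 ∷ a4 ∷ a5 ∷ []) c = a1 ∷ a2 ∷ a3 ∷ a4 ∷ a5 ∷ c ∷ []

voids : State → ℕ
voids (a0 ∷ a1 ∷ a2 ∷ a3 ∷ a4 ∷ a5 ∷ []) = isVoid a0 + isVoid a1 + isVoid a2 + isVoid a3 + isVoid a4 + isVoid a5

-- A finite partial map from states to values: a 5-ary trie, children ordered as the columns
-- void, col false false, col false true, col true false, col true true.
data Table : ℕ → Set where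
  none : ∀ {d} → Table d
  leaf : ℕ → Table 0
  node : ∀ {d} → Table d → Table d → Table d → Table d → Table d → Table (suc d)

lookupT : ∀ {d} → Table d → Vec Column d → Maybe ℕ
lookupT none                   _                    = nothing
lookupT (leaf v)               []                   = just v
lookupT (node t₀ _ _ _ _)      (void ∷ s)           = lookupT t₀ s
lookupT (node _ t₁ _ _ _)      (col false false ∷ s) = lookupT t₁ s
lookupT (node _ _ t₂ _ _)      (col false true ∷ s)  = lookupT t₂ s
lookupT (node _ _ _ t₃ _)      (col true false ∷ s)  = lookupT t₃ s
lookupT (node _ _ _ _ t₄)      (col true true ∷ s)   = lookupT t₄ s

allT : ∀ {d} → Table d → (Vec Column d → ℕ → Bool) → Bool
allT none                  f = true
allT (leaf v)              f = f [] v
allT (node t₀ t₁ t₂ t₃ t₄) f =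
  allT t₀ (λ s → f (void ∷ s)) ∧ allT t₁ (λ s → f (col false false ∷ s)) ∧ allT t₂ (λ s → f (col false true ∷ s)) ∧
  allT t₃ (λ s → f (col true false ∷ s)) ∧ allT t₄ (λ s → f (col true true ∷ s))

allT-sound : ∀ {d} (t : Table d) f → T (allT t f) → ∀ s {v} → lookupT t s ≡ just v → T (f s v)
allT-sound (leaf v)              f h []       refl = h
allT-sound (node t₀ t₁ t₂ t₃ t₄) f h (c ∷ s) eq
  with ∧-split (allT t₀ _) h
... | h₀ , h′ with ∧-split (allT t₁ _) h′
... | h₁ , h″ with ∧-split (allT t₂ _) h″
... | h₂ , h‴ with ∧-split (allT t₃ _) h‴
... | h₃ , h₄ with c
... | void            = allT-sound t₀ _ h₀ s eq
... | col false false = allT-sound t₁ _ h₁ s eq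
... | col false true  = allT-sound t₂ _ h₂ s eq
... | col true false  = allT-sound t₃ _ h₃ s eq
... | col true true   = allT-sound t₄ _ h₄ s eq

allReal : (Column → Bool) → Bool
allReal f = f (col false false) ∧ f (col false true) ∧ f (col true false) ∧ f (col true true)

allReal-sound : ∀ f → T (allReal f) → ∀ c → Real c → T (f c)
allReal-sound f h c _
  with ∧-split (f (col false false)) h
... | h₁ , h′ with ∧-split (f (col false true)) h′
... | h₂ , h″ with ∧-split (f (col true false)) h″
... | h₃ , h₄ with c
... | col false false = h₁
... | col false true  = h₂
... | col true false  = h₃
... | col true true   = h₄

fits : ℕ → Maybe ℕ → Bool
fits a (just v′) = a ≤ᵇ 5 + v′
fits a nothing   = false

fits-sound : ∀ a mv → T (fits a mv) → Σ ℕ λ v′ → mv ≡ just v′ × a ≤ 5 + v′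
fits-sound a (just v′) h = v′ , refl , ≤ᵇ⇒≤ a (5 + v′) h

IsPotential : Bool → Table 6 → Bool
IsPotential z t = allT t λ s v → allReal λ c → allowed z s c ⇒ᵇ fits (4 * weight c + v) (lookupT t (shift s c))

closes : Bool → State → ℕ → Bool
closes z s zero    = true
closes z s (suc k) = allowed z s void ∧ closes z (shift s void) k

ClosingBound : Bool → Table 6 → ℕ → Bool
ClosingBound z t b = allT t λ s v → ((voids s ≤ᵇ 1) ∧ closes z s 6) ⇒ᵇ (v ≤ᵇ b)

window : (ℕ → Column) → ℕ → State
window seq p = seq p ∷ seq (1 + p) ∷ seq (2 + p) ∷ seq (3 + p) ∷ seq (4 + p) ∷ seq (5 + p) ∷ []

weightSum : (ℕ → Column) → ℕ → ℕ → ℕ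
weightSum seq p zero    = 0
weightSum seq p (suc k) = weight (seq (6 + p)) + weightSum seq (suc p) k

amortise : ∀ w w′ v k {v₁ v₂} → 4 * w + v ≤ 5 + v₁ → 4 * w′ + v₁ ≤ 5 * k + v₂ → 4 * (w + w′) + v ≤ 5 * suc k + v₂
amortise w w′ v k {v₁} {v₂} le₁ le₂ = +-cancelʳ-≤ v₁ _ _ (begin
  4 * (w + w′) + v + v₁       ≡⟨ solve 4 (λ w w′ v v₁ → con 4 :* (w :+ w′) :+ v :+ v₁ := (con 4 :* w :+ v) :+ (con 4 :* w′ :+ v₁))
                                        refl w w′ v v₁ ⟩
  (4 * w + v) + (4 * w′ + v₁) ≤⟨ +-mono-≤ le₁ le₂ ⟩
  (5 + v₁) + (5 * k + v₂)     ≡⟨ solve 3 (λ v₁ k v₂ → (con 5 :+ v₁) :+ (con 5 :* k :+ v₂) := con 5 :* (con 1 :+ k) :+ v₂ :+ v₁)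
                                        refl v₁ k v₂ ⟩
  5 * suc k + v₂ + v₁         ∎)
  where open ≤-Reasoning

module Run (z : Bool) (t : Table 6) (potential : T (IsPotential z t))
           (seq : ℕ → Column) (ok : ∀ p → T (allowed z (window seq p) (seq (6 + p)))) where

  step : ∀ p {v} → lookupT t (window seq p) ≡ just v → Real (seq (6 + p)) →
         Σ ℕ λ v′ → lookupT t (window seq (suc p)) ≡ just v′ × 4 * weight (seq (6 + p)) + v ≤ 5 + v′
  step p {v} eq real =
    fits-sound _ _ (⇒ᵇ-elim (allReal-sound gain (allT-sound t _ potential (window seq p) eq) (seq (6 + p)) real) (ok p))
    where
      gain : Column → Bool
      gain c = allowed z (window seq p) c ⇒ᵇ fits (4 * weight c + v) (lookupT t (shift (window seq p) c))

  run : ∀ k p {v} → lookupT t (window seq p) ≡ just v → (∀ j → j < k → Real (seq (6 + (j + p)))) →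
        Σ ℕ λ v′ → lookupT t (window seq (k + p)) ≡ just v′ × 4 * weightSum seq p k + v ≤ 5 * k + v′
  run zero    p {v} eq real = v , eq , ≤-refl
  run (suc k) p {v} eq real with step p eq (real 0 (s≤s z≤n))
  ... | v₁ , eq₁ , le₁ with run k (suc p) eq₁ (λ j j<k → subst (λ q → Real (seq (6 + q))) (sym (+-suc j p))
                                                                (real (suc j) (s≤s j<k)))
  ... | v₂ , eq₂ , le₂ = v₂ , subst (λ q → lookupT t (window seq q) ≡ just v₂) (+-suc k p) eq₂ ,
                         amortise (weight (seq (6 + p))) (weightSum seq (suc p) k) v k le₁ le₂

  closes-from : ∀ k p → (∀ j → seq (6 + (j + p)) ≡ void) → T (closes z (window seq p) k)
  closes-from zero    p _    = tt
  closes-from (suc k) p tail =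
    subst (λ c → T (allowed z (window seq p) c)) (tail 0) (ok p) &
    subst (λ c → T (closes z (shift (window seq p) c) k)) (tail 0)
          (closes-from k (suc p) (λ j → subst (λ q → seq (6 + q) ≡ void) (sym (+-suc j p)) (tail (suc j))))

  voids-≤1 : ∀ a0 {a1 a2 a3 a4 a5} → Real a1 → Real a2 → Real a3 → Real a4 → Real a5 →
             T (voids (a0 ∷ a1 ∷ a2 ∷ a3 ∷ a4 ∷ a5 ∷ []) ≤ᵇ 1)
  voids-≤1 void      {col _ _} {col _ _} {col _ _} {col _ _} {col _ _} _ _ _ _ _ = tt
  voids-≤1 (col _ _) {col _ _} {col _ _} {col _ _} {col _ _} {col _ _} _ _ _ _ _ = tt

  -- Five real columns leave at most one void in the last window, as the closing check assumes.
  last-value≤ : ∀ b → T (ClosingBound z t b) → ∀ m {v} → lookupT t (window seq (5 + m)) ≡ just v →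
                (∀ j → j < 5 + m → Real (seq (6 + j))) → (∀ j → seq (6 + (j + (5 + m))) ≡ void) → v ≤ b
  last-value≤ b closing m eq real tail =
    ≤ᵇ⇒≤ _ b (⇒ᵇ-elim (allT-sound t _ closing (window seq (5 + m)) eq) (few-voids & closes-from 6 (5 + m) tail))
    where
      shifted : ∀ k → k < 5 → Real (seq (6 + (k + m)))
      shifted k k<5 = real (k + m) (+-monoˡ-< m k<5)
      few-voids : T (voids (window seq (5 + m)) ≤ᵇ 1)
      few-voids = voids-≤1 (seq (5 + m)) (shifted 0 (s≤s z≤n)) (shifted 1 (s≤s (s≤s z≤n))) (shifted 2 (s≤s (s≤s (s≤s z≤n))))
                           (shifted 3 (s≤s (s≤s (s≤s (s≤s z≤n))))) (shifted 4 (s≤s (s≤s (s≤s (s≤s (s≤s z≤n))))))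

  weight-bound : ∀ b → T (ClosingBound z t b) → ∀ m {v₀} → lookupT t (window seq 0) ≡ just v₀ →
          (∀ j → j < 5 + m → Real (seq (6 + j))) → (∀ j → seq (6 + (j + (5 + m))) ≡ void) →
          4 * weightSum seq 0 (5 + m) + v₀ ≤ 5 * (5 + m) + b
  weight-bound b closing m {v₀} start real tail = finish (run (5 + m) 0 start real′)
    where
      real′ : ∀ j → j < 5 + m → Real (seq (6 + (j + 0)))
      real′ j j<n = subst (λ q → Real (seq (6 + q))) (sym (+-identityʳ j)) (real j j<n)
      finish : (Σ ℕ λ v → lookupT t (window seq (5 + m + 0)) ≡ just v × 4 * weightSum seq 0 (5 + m) + v₀ ≤ 5 * (5 + m) + v) →
               4 * weightSum seq 0 (5 + m) + v₀ ≤ 5 * (5 + m) + b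
      finish (v , eq , le) = ≤-trans le (+-monoʳ-≤ (5 * (5 + m)) (last-value≤ b closing m eq′ real tail))
        where
          eq′ : lookupT t (window seq (5 + m)) ≡ just v
          eq′ = subst (λ q → lookupT t (window seq q) ≡ just v) (+-identityʳ (5 + m)) eq

table-v*∉S : Table 6
table-v*∉S =
  node
    (node
      (node (node (node (node (leaf 27) (leaf 22) (leaf 26) (leaf 26) (leaf 30)) (node none (leaf 17) (leaf 21) (leaf 21) (leaf 25)) (node none (leaf 21) (leaf 25) (leaf 25) (leaf 29)) (node none (leaf 21) (leaf 25) (leaf 25) (leaf 29)) (node none (leaf 25) (leaf 29) (leaf 29) (leaf 33))) (node none (node none (leaf 12) (leaf 16) (leaf 16) (leaf 20)) (node none (leaf 16) (leaf 20) (leaf 20) (leaf 24)) (node none (leaf 16) (leaf 20) (leaf 20) (leaf 24)) (node none (leaf 20) (leaf 24) (leaf 24) (leaf 28))) (node none (node none (leaf 16) (leaf 20) (leaf 20) (leaf 24)) (node none (leaf 20) (leaf 24) (leaf 24) (leaf 28)) (node none (leaf 20) (leaf 24) none none) (node none (leaf 24) (leaf 28) none none)) (node none (node none (leaf 16) (leaf 20) (leaf 20) (leaf 24)) (node none (leaf 20) (leaf 24) (leaf 24) (leaf 28)) (node none (leaf 20) none (leaf 24) none) (node none (leaf 24) none (leaf 28) none)) (node none (node none (leaf 20) (leaf 24) (leaf 24) (leaf 28)) (node none (leaf 24) (leaf 28) (leaf 28) (leaf 32)) (node none (leaf 24) none none none) (node none (leaf 28) none none none))) (node none (node none (node none (leaf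 7) (leaf 11) (leaf 11) (leaf 15)) (node none (leaf 11) (leaf 15) (leaf 15) (leaf 19)) (node none (leaf 11) (leaf 15) (leaf 15) (leaf 19)) (node none (leaf 15) (leaf 19) (leaf 19) (leaf 23))) (node none (node none (leaf 11) (leaf 15) (leaf 15) (leaf 19)) (node none (leaf 15) (leaf 19) (leaf 19) (leaf 23)) (node none (leaf 15) (leaf 19) none none) (node none (leaf 19) (leaf 23) none none)) (node none (node none (leaf 11) (leaf 15) (leaf 15) (leaf 19)) (node none (leaf 15) (leaf 19) (leaf 19) (leaf 23)) (node none (leaf 15) none (leaf 19) none) (node none (leaf 19) none (leaf 23) none)) (node none (node none (leaf 15) (leaf 19) (leaf 19) (leaf 23)) (node none (leaf 19) (leaf 23) (leaf 23) (leaf 27)) (node none (leaf 19) none none none) (node none (leaf 23) none none none))) (node none (node none (node none (leaf 11) (leaf 15) (leaf 15) (leaf 19)) (node none (leaf 15) (leaf 19) (leaf 19) (leaf 23)) (node none (leaf 15) (leaf 19) (leaf 19) (leaf 23)) (node none (leaf 19) (leaf 23) (leaf 23) (leaf 27))) (node none (node none (leaf 15) (leaf 19) (leaf 19) (leaf 23)) (node none (leaf 19) (leaf 23) (leaf 23) (leaf 27)) (node none (leaf 19) (leaf 23) none none) (node none (leaf 23) (leaf 27) none none)) (node none (node none (leaf 15) (leaf 19) (leaf 19) (leaf 23)) (node none (leaf 19) (leaf 23) (leaf 23) (leaf 27)) none none) (node none (node none (leaf 19) (leaf 23) (leaf 23) (leaf 27)) (node none (leaf 23) (leaf 27) (leaf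 27) (leaf 31)) none none)) (node none (node none (node none (leaf 11) (leaf 15) (leaf 15) (leaf 19)) (node none (leaf 15) (leaf 19) (leaf 19) (leaf 23)) (node none (leaf 15) (leaf 19) (leaf 19) (leaf 23)) (node none (leaf 19) (leaf 23) none none)) (node none (node none (leaf 15) (leaf 19) (leaf 19) (leaf 23)) (node none (leaf 19) (leaf 23) (leaf 23) (leaf 27)) (node none (leaf 19) none none none) (node none (leaf 23) none none none)) (node none (node none (leaf 15) (leaf 19) (leaf 19) (leaf 23)) none (node none (leaf 19) none none none) none) (node none (node none (leaf 19) none none none) none (node none (leaf 23) none none none) none)) (node none (node none (node none (leaf 15) (leaf 19) (leaf 19) (leaf 23)) (node none (leaf 19) (leaf 23) (leaf 23) (leaf 27)) (node none (leaf 19) (leaf 23) (leaf 23) (leaf 27)) (node none (leaf 23) (leaf 27) none none)) (node none (node none (leaf 19) (leaf 23) (leaf 23) (leaf 27)) (node none (leaf 23) (leaf 27) (leaf 27) (leaf 31)) (node none (leaf 23) none none none) (node none (leaf 27) none none none)) (node none (node none (leaf 19) (leaf 23) (leaf 23) (leaf 27)) none none none) (node none (node none (leaf 23) none none none) none none none)))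
      (node none (node none (node none (node none (leaf 2) (leaf 6) (leaf 6) (leaf 10)) (node none (leaf 6) (leaf 10) (leaf 10) (leaf 14)) (node none (leaf 6) (leaf 10) (leaf 10) (leaf 14)) (node none (leaf 10) (leaf 14) (leaf 14) (leaf 18))) (node none (node none (leaf 6) (leaf 10) (leaf 10) (leaf 14)) (node none (leaf 10) (leaf 14) (leaf 14) (leaf 18)) (node none (leaf 10) (leaf 14) none none) (node none (leaf 14) (leaf 18) none none)) (node none (node none (leaf 6) (leaf 10) (leaf 10) (leaf 14)) (node none (leaf 10) (leaf 14) (leaf 14) (leaf 18)) (node none (leaf 10) none (leaf 14) none) (node none (leaf 14) none (leaf 18) none)) (node none (node none (leaf 10) (leaf 14) (leaf 14) (leaf 18)) (node none (leaf 14) (leaf 18) (leaf 18) (leaf 22)) (node none (leaf 14) none none none) (node none (leaf 18) none none none))) (node none (node none (node none (leaf 6) (leaf 10) (leaf 10) (leaf 14)) (node none (leaf 10) (leaf 14) (leaf 14) (leaf 18)) (node none (leaf 10) (leaf 14) (leaf 14) (leaf 18)) (node none (leaf 14) (leaf 18) (leaf 18) (leaf 22))) (node none (node none (leaf 10) (leaf 14) (leaf 14) (leaf 18)) (node none (leaf 14) (leaf 18) (leaf 18) (leaf 22)) (node none (leaf 14) (leaf 18) none none) (node none (leaf 18) (leaf 22) none none)) (node none (node none (leaf 10) (leaf 14) (leaf 14) (leaf 18)) (node none (leaf 14) (leaf 18) (leaf 18) (leaf 22)) none none) (node none (node none (leaf 14) (leaf 18) (leaf 18) (leaf 22)) (node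 none (leaf 18) (leaf 22) (leaf 22) (leaf 26)) none none)) (node none (node none (node none (leaf 6) (leaf 10) (leaf 10) (leaf 14)) (node none (leaf 10) (leaf 14) (leaf 14) (leaf 18)) (node none (leaf 10) (leaf 14) (leaf 14) (leaf 18)) (node none (leaf 14) (leaf 18) none none)) (node none (node none (leaf 10) (leaf 14) (leaf 14) (leaf 18)) (node none (leaf 14) (leaf 18) (leaf 18) (leaf 22)) (node none (leaf 14) (leaf 18) none none) (node none (leaf 18) (leaf 22) none none)) (node none (node none (leaf 10) (leaf 14) (leaf 14) (leaf 18)) none (node none (leaf 14) none none none) none) (node none (node none (leaf 14) (leaf 18) none none) none (node none (leaf 18) none none none) none)) (node none (node none (node none (leaf 10) (leaf 14) (leaf 14) (leaf 18)) (node none (leaf 14) (leaf 18) (leaf 18) (leaf 22)) (node none (leaf 14) (leaf 18) (leaf 18) (leaf 22)) (node none (leaf 18) (leaf 22) none none)) (node none (node none (leaf 14) (leaf 18) (leaf 18) (leaf 22)) (node none (leaf 18) (leaf 22) (leaf 22) (leaf 26)) (node none (leaf 18) (leaf 22) none none) (node none (leaf 22) (leaf 26) none none)) (node none (node none (leaf 14) (leaf 18) (leaf 18) (leaf 22)) none none none) (node none (node none (leaf 18) (leaf 22) none none) none none none)))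
      (node none (node none (node none (node none (leaf 6) (leaf 10) (leaf 10) (leaf 14)) (node none (leaf 10) (leaf 14) (leaf 14) (leaf 18)) (node none (leaf 10) (leaf 14) (leaf 14) (leaf 18)) (node none (leaf 14) (leaf 18) (leaf 18) (leaf 22))) (node none (node none (leaf 10) (leaf 14) (leaf 14) (leaf 18)) (node none (leaf 14) (leaf 18) (leaf 18) (leaf 22)) (node none (leaf 14) (leaf 18) none none) (node none (leaf 18) (leaf 22) none none)) (node none (node none (leaf 10) (leaf 14) (leaf 14) (leaf 18)) (node none (leaf 14) (leaf 18) (leaf 18) (leaf 22)) (node none (leaf 14) none (leaf 18) none) (node none (leaf 18) none (leaf 22) none)) (node none (node none (leaf 14) (leaf 18) (leaf 18) (leaf 22)) (node none (leaf 18) (leaf 22) (leaf 22) (leaf 26)) (node none (leaf 18) none none none) (node none (leaf 22) none none none))) (node none (node none (node none (leaf 10) (leaf 14) (leaf 14) (leaf 18)) (node none (leaf 14) (leaf 18) (leaf 18) (leaf 22)) (node none (leaf 14) (leaf 18) (leaf 18) (leaf 22)) (node none (leaf 18) (leaf 22) (leaf 22) (leaf 26))) (node none (node none (leaf 14) (leaf 18) (leaf 18) (leaf 22)) (node none (leaf 18) (leaf 22) (leaf 22) (leaf 26)) (node none (leaf 18) (leaf 22) none none) (node none (leaf 22) (leaf 26) none none)) (node none (node none (leaf 14) (leaf 18) (leaf 18) (leaf 22)) (node none (leaf 18) (leaf 22) (leaf 22) (leaf 26)) none none) (node none (node none (leaf 18) (leaf 22) (leaf 22) (leaf 26)) (node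 none (leaf 22) (leaf 26) (leaf 26) (leaf 30)) none none)) (node none (node none (node none (leaf 10) (leaf 14) (leaf 14) (leaf 18)) (node none (leaf 14) (leaf 18) (leaf 18) (leaf 22)) (node none (leaf 14) (leaf 18) (leaf 18) (leaf 22)) (node none (leaf 18) (leaf 22) none none)) (node none (node none (leaf 14) (leaf 18) (leaf 18) (leaf 22)) (node none (leaf 18) (leaf 22) (leaf 22) (leaf 26)) (node none (leaf 18) none none none) (node none (leaf 22) none none none)) none none) (node none (node none (node none (leaf 14) (leaf 18) (leaf 18) (leaf 22)) (node none (leaf 18) (leaf 22) (leaf 22) (leaf 26)) (node none (leaf 18) (leaf 22) (leaf 22) (leaf 26)) (node none (leaf 22) (leaf 26) none none)) (node none (node none (leaf 18) (leaf 22) (leaf 22) (leaf 26)) (node none (leaf 22) (leaf 26) (leaf 26) (leaf 30)) (node none (leaf 22) none none none) (node none (leaf 26) none none none)) none none))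
      (node none (node none (node none (node none (leaf 6) (leaf 10) (leaf 10) (leaf 14)) (node none (leaf 10) (leaf 14) (leaf 14) (leaf 18)) (node none (leaf 10) (leaf 14) (leaf 14) (leaf 18)) (node none (leaf 14) (leaf 18) (leaf 18) (leaf 22))) (node none (node none (leaf 10) (leaf 14) (leaf 14) (leaf 18)) (node none (leaf 14) (leaf 18) (leaf 18) (leaf 22)) (node none (leaf 14) (leaf 18) none none) (node none (leaf 18) (leaf 22) none none)) (node none (node none (leaf 10) (leaf 14) (leaf 14) (leaf 18)) (node none (leaf 14) (leaf 18) (leaf 18) (leaf 22)) (node none (leaf 14) none (leaf 18) none) (node none (leaf 18) none (leaf 22) none)) (node none (node none (leaf 14) (leaf 18) (leaf 18) (leaf 22)) (node none (leaf 18) (leaf 22) (leaf 22) (leaf 26)) none none)) (node none (node none (node none (leaf 10) none (leaf 14) none) (node none (leaf 14) none (leaf 18) none) (node none (leaf 14) none (leaf 18) none) (node none (leaf 18) none (leaf 22) none)) (node none (node none (leaf 14) none (leaf 18) none) (node none (leaf 18) none (leaf 22) none) (node none (leaf 18) none none none) (node none (leaf 22) none none none)) (node none (node none (leaf 14) none (leaf 18) none) none none none) (node none (node none (leaf 18) none (leaf 22) none) none none none)) (node none (node none (node none (leaf 10) (leaf 14) (leaf 14) (leaf 18)) (node none (leaf 14) (leaf 18) (leaf 18) (leaf 22)) (node none (leaf 14) (leaf 18) (leaf 18) (leaf 22)) (node none (leaf 18) (leaf 22) none none)) none (node none (node none (leaf 14) (leaf 18) (leaf 18) (leaf 22)) none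 none none) none) (node none (node none (node none (leaf 14) none (leaf 18) none) none none none) none (node none (node none (leaf 18) none (leaf 22) none) none none none) none))
      (node none (node none (node none (node none (leaf 10) (leaf 14) (leaf 14) (leaf 18)) (node none (leaf 14) (leaf 18) (leaf 18) (leaf 22)) (node none (leaf 14) (leaf 18) (leaf 18) (leaf 22)) (node none (leaf 18) (leaf 22) (leaf 22) (leaf 26))) (node none (node none (leaf 14) (leaf 18) (leaf 18) (leaf 22)) (node none (leaf 18) (leaf 22) (leaf 22) (leaf 26)) (node none (leaf 18) (leaf 22) none none) (node none (leaf 22) (leaf 26) none none)) (node none (node none (leaf 14) (leaf 18) (leaf 18) (leaf 22)) (node none (leaf 18) (leaf 22) (leaf 22) (leaf 26)) (node none (leaf 18) none (leaf 22) none) (node none (leaf 22) none (leaf 26) none)) (node none (node none (leaf 18) (leaf 22) (leaf 22) (leaf 26)) (node none (leaf 22) (leaf 26) (leaf 26) (leaf 30)) none none)) (node none (node none (node none (leaf 14) none (leaf 18) none) (node none (leaf 18) none (leaf 22) none) (node none (leaf 18) none (leaf 22) none) (node none (leaf 22) none (leaf 26) none)) (node none (node none (leaf 18) none (leaf 22) none) (node none (leaf 22) none (leaf 26) none) (node none (leaf 22) none none none) (node none (leaf 26) none none none)) (node none (node none (leaf 18) none (leaf 22) none) none none none) (node none (node none (leaf 22) none (leaf 26) none) none none none)) (node none (node none (node none (leaf 14) (leaf 18) (leaf 18) (leaf 22)) (node none (leaf 18) (leaf 22) (leaf 22) (leaf 26)) (node none (leaf 18) (leaf 22) (leaf 22)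 (leaf 26)) (node none (leaf 22) (leaf 26) none none)) none none none) (node none (node none (node none (leaf 18) none (leaf 22) none) none none none) none none none)))
    (node
      none
      (node none (node none (node none (node none (leaf 3) (leaf 7) (leaf 7) (leaf 11)) (node none (leaf 7) (leaf 11) (leaf 11) (leaf 15)) (node none (leaf 7) (leaf 11) (leaf 11) (leaf 15)) (node none (leaf 11) (leaf 15) (leaf 15) (leaf 19))) (node none (node none (leaf 6) (leaf 10) (leaf 10) (leaf 14)) (node none (leaf 10) (leaf 14) (leaf 14) (leaf 18)) (node none (leaf 10) (leaf 11) none none) (node none (leaf 14) (leaf 15) none none)) (node none (node none (leaf 7) (leaf 11) (leaf 11) (leaf 15)) (node none (leaf 11) (leaf 15) (leaf 15) (leaf 19)) (node none (leaf 11) none (leaf 15) none) (node none (leaf 15) none (leaf 19) none)) (node none (node none (leaf 10) (leaf 14) (leaf 14) (leaf 18)) (node none (leaf 14) (leaf 18) (leaf 18) (leaf 22)) (node none (leaf 14) none none none) (node none (leaf 18) none none none))) (node none (node none (node none (leaf 5) (leaf 9) (leaf 9) (leaf 13)) (node none (leaf 9) (leaf 13) (leaf 13) (leaf 17)) (node none (leaf 9) (leaf 13) (leaf 13) (leaf 17)) (node none (leaf 13) (leaf 17) (leaf 17) (leaf 21))) (node none (node none (leaf 9) (leaf 13) (leaf 13) (leaf 17)) (node none (leaf 13) (leaf 17) (leaf 17) (leaf 21)) (node none (leaf 13) (leaf 15) none none) (node none (leaf 17) (leaf 19) none none)) (node none (node none (leaf 9) (leaf 13) (leaf 13) (leaf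 17)) (node none (leaf 9) (leaf 13) (leaf 13) (leaf 17)) none none) (node none (node none (leaf 13) (leaf 17) (leaf 17) (leaf 21)) (node none (leaf 13) (leaf 17) (leaf 17) (leaf 21)) none none)) (node none (node none (node none (leaf 7) (leaf 11) (leaf 11) (leaf 15)) (node none (leaf 11) (leaf 15) (leaf 15) (leaf 19)) (node none (leaf 11) (leaf 15) (leaf 15) (leaf 19)) (node none (leaf 15) (leaf 19) none none)) (node none (node none (leaf 10) (leaf 14) (leaf 14) (leaf 18)) (node none (leaf 14) (leaf 18) (leaf 18) (leaf 22)) (node none (leaf 14) (leaf 15) none none) (node none (leaf 18) (leaf 19) none none)) (node none (node none (leaf 11) (leaf 15) (leaf 15) (leaf 19)) none (node none (leaf 15) none none none) none) (node none (node none (leaf 14) (leaf 18) none none) none (node none (leaf 18) none none none) none)) (node none (node none (node none (leaf 9) (leaf 13) (leaf 13) (leaf 17)) (node none (leaf 13) (leaf 17) (leaf 17) (leaf 21)) (node none (leaf 13) (leaf 17) (leaf 17) (leaf 21)) (node none (leaf 17) (leaf 21) none none)) (node none (node none (leaf 13) (leaf 17) (leaf 17) (leaf 21)) (node none (leaf 17) (leaf 21) (leaf 21) (leaf 25)) (node none (leaf 17) (leaf 19) none none) (node none (leaf 21) (leaf 23) none none)) (node none (node none (leaf 13) (leaf 17) (leaf 17) (leaf 21)) none none none) (node none (node none (leaf 17) (leaf 21) none none) none none none)))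
      (node none (node none (node none (node none (leaf 4) (leaf 8) (leaf 8) (leaf 12)) (node none (leaf 8) (leaf 12) (leaf 12) (leaf 16)) (node none (leaf 8) (leaf 12) (leaf 12) (leaf 16)) (node none (leaf 12) (leaf 16) (leaf 16) (leaf 20))) (node none (node none (leaf 8) (leaf 12) (leaf 12) (leaf 16)) (node none (leaf 12) (leaf 16) (leaf 16) (leaf 20)) (node none (leaf 12) (leaf 15) none none) (node none (leaf 16) (leaf 19) none none)) (node none (node none (leaf 8) (leaf 12) (leaf 12) (leaf 16)) (node none (leaf 12) (leaf 16) (leaf 16) (leaf 20)) (node none (leaf 12) none (leaf 16) none) (node none (leaf 16) none (leaf 20) none)) (node none (node none (leaf 12) (leaf 16) (leaf 16) (leaf 20)) (node none (leaf 16) (leaf 20) (leaf 20) (leaf 24)) (node none (leaf 16) none none none) (node none (leaf 20) none none none))) (node none (node none (node none (leaf 8) (leaf 12) (leaf 12) (leaf 16)) (node none (leaf 12) (leaf 16) (leaf 16) (leaf 20)) (node none (leaf 12) (leaf 16) (leaf 16) (leaf 20)) (node none (leaf 16) (leaf 20) (leaf 20) (leaf 24))) (node none (node none (leaf 12) (leaf 16) (leaf 16) (leaf 20)) (node none (leaf 16) (leaf 20) (leaf 20) (leaf 24)) (node none (leaf 16) (leaf 19) none none) (node none (leaf 20) (leaf 23) none none)) (node none (node none (leaf 12) (leaf 16) (leaf 16) (leaf 20)) (node none (leaf 13) (leaf 17) (leaf 17) (leaf 21)) none none) (node none (node none (leaf 16) (leaf 20) (leaf 20) (leaf 24)) (node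 none (leaf 17) (leaf 21) (leaf 21) (leaf 25)) none none)) (node none (node none (node none (leaf 8) (leaf 12) (leaf 12) (leaf 16)) (node none (leaf 12) (leaf 16) (leaf 16) (leaf 20)) (node none (leaf 12) (leaf 16) (leaf 16) (leaf 20)) (node none (leaf 16) (leaf 20) none none)) (node none (node none (leaf 12) (leaf 16) (leaf 16) (leaf 20)) (node none (leaf 16) (leaf 20) (leaf 20) (leaf 24)) (node none (leaf 16) none none none) (node none (leaf 20) none none none)) none none) (node none (node none (node none (leaf 12) (leaf 16) (leaf 16) (leaf 20)) (node none (leaf 16) (leaf 20) (leaf 20) (leaf 24)) (node none (leaf 16) (leaf 20) (leaf 20) (leaf 24)) (node none (leaf 20) (leaf 24) none none)) (node none (node none (leaf 16) (leaf 20) (leaf 20) (leaf 24)) (node none (leaf 20) (leaf 24) (leaf 24) (leaf 28)) (node none (leaf 20) none none none) (node none (leaf 24) none none none)) none none))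
      (node none (node none (node none (node none (leaf 6) (leaf 10) (leaf 10) (leaf 14)) (node none (leaf 10) (leaf 14) (leaf 14) (leaf 18)) (node none (leaf 10) (leaf 14) (leaf 14) (leaf 18)) (node none (leaf 14) (leaf 18) (leaf 18) (leaf 22))) (node none (node none (leaf 10) (leaf 14) (leaf 14) (leaf 18)) (node none (leaf 14) (leaf 18) (leaf 18) (leaf 22)) (node none (leaf 14) (leaf 15) none none) (node none (leaf 18) (leaf 19) none none)) (node none (node none (leaf 10) (leaf 14) (leaf 14) (leaf 18)) (node none (leaf 14) (leaf 18) (leaf 18) (leaf 22)) (node none (leaf 14) none (leaf 18) none) (node none (leaf 18) none (leaf 22) none)) (node none (node none (leaf 14) (leaf 18) (leaf 18) (leaf 22)) (node none (leaf 18) (leaf 22) (leaf 22) (leaf 26)) none none)) (node none (node none (node none (leaf 9) (leaf 13) (leaf 13) (leaf 17)) (node none (leaf 13) (leaf 17) (leaf 17) (leaf 21)) (node none (leaf 13) (leaf 17) (leaf 17) (leaf 21)) (node none (leaf 17) (leaf 21) (leaf 21) (leaf 25))) (node none (node none (leaf 13) (leaf 17) (leaf 17) (leaf 21)) (node none (leaf 17) (leaf 21) (leaf 21) (leaf 25)) (node none (leaf 17) (leaf 19) none none) (node none (leaf 21) (leaf 23) none none)) (node none (node none (leaf 13) (leaf 17) (leaf 17) (leaf 21)) (node none (leaf 13) (leaf 17) (leaf 17) (leaf 21)) none none) (node none (node none (leaf 17) (leaf 21) (leaf 21) (leaf 25)) (node none (leaf 17) (leaf 21) (leaf 21) (leaf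 25)) none none)) (node none (node none (node none (leaf 10) (leaf 14) (leaf 14) (leaf 18)) (node none (leaf 14) (leaf 18) (leaf 18) (leaf 22)) (node none (leaf 14) (leaf 18) (leaf 18) (leaf 22)) (node none (leaf 18) (leaf 22) none none)) none (node none (node none (leaf 14) (leaf 18) (leaf 18) (leaf 22)) none none none) none) (node none (node none (node none (leaf 13) (leaf 17) (leaf 17) (leaf 21)) (node none (leaf 17) (leaf 21) (leaf 21) (leaf 25)) none none) none (node none (node none (leaf 17) (leaf 21) (leaf 21) (leaf 25)) none none none) none))
      (node none (node none (node none (node none (leaf 8) (leaf 12) (leaf 12) (leaf 16)) (node none (leaf 12) (leaf 16) (leaf 16) (leaf 20)) (node none (leaf 12) (leaf 16) (leaf 16) (leaf 20)) (node none (leaf 16) (leaf 20) (leaf 20) (leaf 24))) (node none (node none (leaf 12) (leaf 16) (leaf 16) (leaf 20)) (node none (leaf 16) (leaf 20) (leaf 20) (leaf 24)) (node none (leaf 16) (leaf 19) none none) (node none (leaf 20) (leaf 23) none none)) (node none (node none (leaf 12) (leaf 16) (leaf 16) (leaf 20)) (node none (leaf 16) (leaf 20) (leaf 20) (leaf 24)) (node none (leaf 16) none (leaf 20) none) (node none (leaf 20) none (leaf 24) none)) (node none (node none (leaf 16) (leaf 20) (leaf 20) (leaf 24)) (node none (leaf 20) (leaf 24) (leaf 24) (leaf 28)) none none)) (node none (node none (node none (leaf 12) (leaf 16) (leaf 16) (leaf 20)) (node none (leaf 16) (leaf 20) (leaf 20) (leaf 24)) (node none (leaf 16) (leaf 20)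 (leaf 20) (leaf 24)) (node none (leaf 20) (leaf 24) (leaf 24) (leaf 28))) (node none (node none (leaf 16) (leaf 20) (leaf 20) (leaf 24)) (node none (leaf 20) (leaf 24) (leaf 24) (leaf 28)) (node none (leaf 20) (leaf 23) none none) (node none (leaf 24) (leaf 27) none none)) (node none (node none (leaf 16) (leaf 20) (leaf 20) (leaf 24)) (node none (leaf 17) (leaf 21) (leaf 21) (leaf 25)) none none) (node none (node none (leaf 20) (leaf 24) (leaf 24) (leaf 28)) (node none (leaf 21) (leaf 25) (leaf 25) (leaf 29)) none none)) (node none (node none (node none (leaf 11) (leaf 15) (leaf 15) (leaf 19)) (node none (leaf 15) (leaf 19) (leaf 19) (leaf 23)) (node none (leaf 15) (leaf 19) (leaf 19) (leaf 23)) (node none (leaf 19) (leaf 23) none none)) none none none) (node none (node none (node none (leaf 13) (leaf 17) (leaf 17) (leaf 21)) (node none (leaf 17) (leaf 21) (leaf 21) (leaf 25)) none none) none none none)))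
    (node
      none
      (node none (node none (node none (node none (leaf 4) (leaf 8) (leaf 8) (leaf 12)) (node none (leaf 7) (leaf 11) (leaf 11) (leaf 15)) (node none (leaf 8) (leaf 12) (leaf 12) (leaf 16)) (node none (leaf 11) (leaf 15) (leaf 15) (leaf 19))) (node none (node none (leaf 6) (leaf 10) (leaf 10) (leaf 14)) (node none (leaf 10) (leaf 14) (leaf 14) (leaf 18)) (node none (leaf 10) none none none) (node none (leaf 14) none none none)) (node none (node none (leaf 8) (leaf 12) (leaf 12) (leaf 16)) (node none (leaf 11) (leaf 15) (leaf 15) (leaf 19)) (node none (leaf 12) none (leaf 16) none) (node none (leaf 15) none (leaf 19) none)) (node none (node none (leaf 10) (leaf 14) (leaf 14) (leaf 18)) (node none (leaf 14) (leaf 18) (leaf 18) (leaf 22)) (node none (leaf 14) none none none) (node none (leaf 18) none none none))) (node none (node none (node none (leaf 8) (leaf 12) (leaf 12) (leaf 16)) (node none (leaf 10) (leaf 14) (leaf 14) (leaf 18)) (node none (leaf 12) (leaf 16) (leaf 16) (leaf 20)) (node none (leaf 14) (leaf 18) (leaf 18) (leaf 22))) (node none (node none (leaf 10) (leaf 14) (leaf 14) (leaf 18)) (node none (leaf 14) (leaf 18) (leaf 18) (leaf 22)) (node none (leaf 14) none none none) (node none (leaf 18) none none none)) (node none (node none (leaf 12) (leaf 16) (leaf 16) (leaf 20)) (node none (leaf 13) (leaf 17) (leaf 17) (leaf 21)) none none) (node none (node none (leaf 14) (leaf 18) (leaf 18) (leaf 22)) (node none (leaf 17) (leaf 21) (leaf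 21) (leaf 25)) none none)) (node none (node none (node none (leaf 8) (leaf 12) (leaf 12) (leaf 16)) (node none (leaf 11) (leaf 15) (leaf 15) (leaf 19)) (node none (leaf 12) (leaf 16) (leaf 16) (leaf 20)) (node none (leaf 15) (leaf 19) none none)) (node none (node none (leaf 10) (leaf 14) (leaf 14) (leaf 18)) (node none (leaf 14) (leaf 18) (leaf 18) (leaf 22)) (node none (leaf 14) none none none) (node none (leaf 18) none none none)) (node none (node none (leaf 12) (leaf 16) (leaf 16) (leaf 20)) none (node none (leaf 16) none none none) none) (node none (node none (leaf 14) (leaf 18) none none) none (node none (leaf 18) none none none) none)) (node none (node none (node none (leaf 12) (leaf 16) (leaf 16) (leaf 20)) (node none (leaf 14) (leaf 18) (leaf 18) (leaf 22)) (node none (leaf 16) (leaf 20) (leaf 20) (leaf 24)) (node none (leaf 18) (leaf 22) none none)) (node none (node none (leaf 14) (leaf 18) (leaf 18) (leaf 22)) (node none (leaf 18) (leaf 22) (leaf 22) (leaf 26)) (node none (leaf 18) none none none) (node none (leaf 22) none none none)) (node none (node none (leaf 16) (leaf 20) (leaf 20) (leaf 24)) none none none) (node none (node none (leaf 18) (leaf 22) none none) none none none)))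
      (node none (node none (node none (node none (leaf 8) (leaf 12) (leaf 12) (leaf 16)) (node none (leaf 11) (leaf 15) (leaf 15) (leaf 19)) (node none (leaf 12) (leaf 16) (leaf 16) (leaf 20)) (node none (leaf 15) (leaf 19) (leaf 19) (leaf 23))) (node none (node none (leaf 10) (leaf 14) (leaf 14) (leaf 18)) (node none (leaf 14) (leaf 18) (leaf 18) (leaf 22)) (node none (leaf 14) none none none) (node none (leaf 18) none none none)) (node none (node none (leaf 12) (leaf 16) (leaf 16) (leaf 20)) (node none (leaf 15) (leaf 19) (leaf 19) (leaf 23)) (node none (leaf 16) none (leaf 20) none) (node none (leaf 19) none (leaf 23) none)) (node none (node none (leaf 14) (leaf 18) (leaf 18) (leaf 22)) (node none (leaf 18) (leaf 22) (leaf 22) (leaf 26)) (node none (leaf 18) none none none) (node none (leaf 22) none none none))) (node none (node none (node none (leaf 12) (leaf 16) (leaf 16) (leaf 20)) (node none (leaf 14) (leaf 18) (leaf 18) (leaf 22)) (node none (leaf 16) (leaf 20) (leaf 20) (leaf 24)) (node none (leaf 18) (leaf 22) (leaf 22) (leaf 26))) (node none (node none (leaf 14) (leaf 18) (leaf 18) (leaf 22)) (node none (leaf 18) (leaf 22) (leaf 22) (leaf 26)) (node none (leaf 18) none none none) (node none (leaf 22) none none none)) (node none (node none (leaf 16) (leaf 20) (leaf 20) (leaf 24)) (node none (leaf 17) (leaf 21) (leaf 21) (leaf 25)) none none) (node none (node none (leaf 18) (leaf 22) (leaf 22) (leaf 26)) (node none (leaf 21) (leaf 25) (leaf 25) (leaf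 29)) none none)) (node none (node none (node none (leaf 12) (leaf 16) (leaf 16) (leaf 20)) (node none (leaf 15) (leaf 19) (leaf 19) (leaf 23)) (node none (leaf 16) (leaf 20) (leaf 20) (leaf 24)) (node none (leaf 19) (leaf 23) none none)) (node none (node none (leaf 13) (leaf 17) (leaf 17) (leaf 21)) (node none (leaf 17) (leaf 21) (leaf 21) (leaf 25)) (node none (leaf 17) none none none) (node none (leaf 21) none none none)) none none) (node none (node none (node none (leaf 16) (leaf 20) (leaf 20) (leaf 24)) (node none (leaf 18) (leaf 22) (leaf 22) (leaf 26)) (node none (leaf 20) (leaf 24) (leaf 24) (leaf 28)) (node none (leaf 22) (leaf 26) none none)) (node none (node none (leaf 17) (leaf 21) (leaf 21) (leaf 25)) (node none (leaf 21) (leaf 25) (leaf 25) (leaf 29)) (node none (leaf 21) none none none) (node none (leaf 25) none none none)) none none))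
      (node none (node none (node none (node none (leaf 8) (leaf 12) (leaf 12) (leaf 16)) (node none (leaf 11) (leaf 15) (leaf 15) (leaf 19)) (node none (leaf 12) (leaf 16) (leaf 16) (leaf 20)) (node none (leaf 15) (leaf 19) (leaf 19) (leaf 23))) (node none (node none (leaf 10) (leaf 14) (leaf 14) (leaf 18)) (node none (leaf 14) (leaf 18) (leaf 18) (leaf 22)) (node none (leaf 14) none none none) (node none (leaf 18) none none none)) (node none (node none (leaf 12) (leaf 16) (leaf 16) (leaf 20)) (node none (leaf 15) (leaf 19) (leaf 19) (leaf 23)) (node none (leaf 16) none (leaf 20) none) (node none (leaf 19) none (leaf 23) none)) (node none (node none (leaf 14) (leaf 18) (leaf 18) (leaf 22)) (node none (leaf 18) (leaf 22) (leaf 22) (leaf 26)) none none)) (node none (node none (node none (leaf 9) none (leaf 13) none) (node none (leaf 13) none (leaf 17) none) (node none (leaf 13) none (leaf 17) none) (node none (leaf 17) none (leaf 21) none)) (node none (node none (leaf 13) none (leaf 17) none) (node none (leaf 17) none (leaf 21) none) (node none (leaf 17) none none none) (node none (leaf 21) none none none)) (node none (node none (leaf 13) none (leaf 17) none) none none none) (node none (node none (leaf 17) none (leaf 21) none) none none none)) none none)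
      (node none (node none (node none (node none (leaf 12) (leaf 16) (leaf 16) (leaf 20)) (node none (leaf 15) (leaf 19) (leaf 19) (leaf 23)) (node none (leaf 16) (leaf 20) (leaf 20) (leaf 24)) (node none (leaf 19) (leaf 23) (leaf 23) (leaf 27))) (node none (node none (leaf 14) (leaf 18) (leaf 18) (leaf 22)) (node none (leaf 18) (leaf 22) (leaf 22) (leaf 26)) (node none (leaf 18) none none none) (node none (leaf 22) none none none)) (node none (node none (leaf 16) (leaf 20) (leaf 20) (leaf 24)) (node none (leaf 19) (leaf 23) (leaf 23) (leaf 27)) (node none (leaf 20) none (leaf 24) none) (node none (leaf 23) none (leaf 27) none)) (node none (node none (leaf 18) (leaf 22) (leaf 22) (leaf 26)) (node none (leaf 22) (leaf 26) (leaf 26) (leaf 30)) none none)) (node none (node none (node none (leaf 13) none (leaf 17) none) (node none (leaf 17) none (leaf 21) none) (node none (leaf 17) none (leaf 21) none) (node none (leaf 21) none (leaf 25) none)) (node none (node none (leaf 17) none (leaf 21) none) (node none (leaf 21) none (leaf 25) none) (node none (leaf 21) none none none) (node none (leaf 25) none none none)) (node none (node none (leaf 17) none (leaf 21) none) none none none) (node none (node none (leaf 21) none (leaf 25) none) none none none)) none none))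
    (node
      none
      (node none (node none (node none (node none (leaf 4) (leaf 8) (leaf 8) (leaf 12)) (node none (leaf 8) (leaf 12) (leaf 12) (leaf 16)) (node none (leaf 8) (leaf 12) (leaf 12) (leaf 16)) (node none (leaf 12) (leaf 16) (leaf 16) (leaf 20))) (node none (node none (leaf 8) (leaf 12) (leaf 12) (leaf 16)) (node none (leaf 12) (leaf 16) (leaf 16) (leaf 20)) (node none (leaf 12) (leaf 13) none none) (node none (leaf 16) (leaf 17) none none)) (node none (node none (leaf 8) (leaf 12) (leaf 12) (leaf 16)) (node none (leaf 12) (leaf 16) (leaf 16) (leaf 20)) (node none (leaf 12) none (leaf 16) none) (node none (leaf 16) none (leaf 20) none)) (node none (node none (leaf 12) (leaf 16) (leaf 16) (leaf 20)) (node none (leaf 16) (leaf 20) (leaf 20) (leaf 24)) (node none (leaf 16) none none none) (node none (leaf 20) none none none))) (node none (node none (node none (leaf 8) (leaf 12) (leaf 12) (leaf 16)) (node none (leaf 12) (leaf 16) (leaf 16) (leaf 20)) (node none (leaf 12) (leaf 16) (leaf 16) (leaf 20)) (node none (leaf 16) (leaf 20) (leaf 20) (leaf 24))) (node none (node none (leaf 12) (leaf 16) (leaf 16) (leaf 20)) (node none (leaf 16) (leaf 20) (leaf 20) (leaf 24)) (node none (leaf 16) (leaf 17) none none) (node none (leaf 20) (leaf 21) none none)) (node none (node none (leaf 12) (leaf 16) (leaf 16) (leaf 20)) (node none (leaf 13) (leaf 17) (leaf 17) (leaf 21)) none none) (node none (node none (leaf 16) (leaf 20) (leaf 20) (leaf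 24)) (node none (leaf 17) (leaf 21) (leaf 21) (leaf 25)) none none)) (node none (node none (node none (leaf 8) (leaf 12) (leaf 12) (leaf 16)) (node none (leaf 12) (leaf 16) (leaf 16) (leaf 20)) (node none (leaf 12) (leaf 16) (leaf 16) (leaf 20)) (node none (leaf 16) (leaf 20) none none)) (node none (node none (leaf 12) (leaf 16) (leaf 16) (leaf 20)) (node none (leaf 16) (leaf 20) (leaf 20) (leaf 24)) (node none (leaf 16) (leaf 17) none none) (node none (leaf 20) (leaf 21) none none)) (node none (node none (leaf 12) (leaf 16) (leaf 16) (leaf 20)) none (node none (leaf 16) none none none) none) (node none (node none (leaf 16) (leaf 20) none none) none (node none (leaf 20) none none none) none)) (node none (node none (node none (leaf 12) (leaf 16) (leaf 16) (leaf 20)) (node none (leaf 16) (leaf 20) (leaf 20) (leaf 24)) (node none (leaf 16) (leaf 20) (leaf 20) (leaf 24)) (node none (leaf 20) (leaf 24) none none)) (node none (node none (leaf 16) (leaf 20) (leaf 20) (leaf 24)) (node none (leaf 20) (leaf 24) (leaf 24) (leaf 28)) (node none (leaf 20) (leaf 21) none none) (node none (leaf 24) (leaf 25) none none)) none none))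
      (node none (node none (node none (node none (leaf 5) (leaf 8) (leaf 9) (leaf 12)) (node none (leaf 8) (leaf 12) (leaf 12) (leaf 16)) (node none (leaf 9) (leaf 12) (leaf 13) (leaf 16)) (node none (leaf 12) (leaf 16) (leaf 16) (leaf 20))) (node none (node none (leaf 9) (leaf 12) (leaf 13) (leaf 16)) (node none (leaf 12) (leaf 16) (leaf 16) (leaf 20)) (node none (leaf 13) (leaf 16) none none) (node none (leaf 16) (leaf 20) none none)) (node none (node none (leaf 9) (leaf 12) (leaf 13) (leaf 16)) (node none (leaf 12) (leaf 16) (leaf 16) (leaf 20)) (node none (leaf 13) none (leaf 17) none) (node none (leaf 16) none (leaf 20) none)) (node none (node none (leaf 13) (leaf 16) (leaf 17) (leaf 20)) (node none (leaf 16) (leaf 20) (leaf 20) (leaf 24)) (node none (leaf 17) none none none) (node none (leaf 20) none none none))) (node none (node none (node none (leaf 9) (leaf 12) (leaf 13) (leaf 16)) (node none (leaf 12) (leaf 16) (leaf 16) (leaf 20)) (node none (leaf 13) (leaf 16) (leaf 17) (leaf 20)) (node none (leaf 16) (leaf 20) (leaf 20) (leaf 24))) (node none (node none (leaf 13) (leaf 16) (leaf 17) (leaf 20)) (node none (leaf 16) (leaf 20) (leaf 20) (leaf 24)) (node none (leaf 17) (leaf 20) none none) (node none (leaf 20) (leaf 24) none none)) (node none (node none (leaf 13) (leaf 16) (leaf 17) (leaf 20)) (node none (leaf 14) (leaf 18) (leaf 18) (leaf 22)) none none) (node none (node none (leaf 17) (leaf 20) (leaf 21) (leaf 24)) (node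 none (leaf 18) (leaf 22) (leaf 22) (leaf 26)) none none)) (node none (node none (node none (leaf 9) (leaf 12) (leaf 13) (leaf 16)) (node none (leaf 12) (leaf 16) (leaf 16) (leaf 20)) (node none (leaf 13) (leaf 16) (leaf 17) (leaf 20)) (node none (leaf 16) (leaf 20) none none)) (node none (node none (leaf 8) (leaf 12) (leaf 12) (leaf 16)) (node none (leaf 12) (leaf 16) (leaf 16) (leaf 20)) (node none (leaf 12) none none none) (node none (leaf 16) none none none)) none none) (node none (node none (node none (leaf 13) (leaf 16) (leaf 17) (leaf 20)) (node none (leaf 16) (leaf 20) (leaf 20) (leaf 24)) (node none (leaf 17) (leaf 20) (leaf 21) (leaf 24)) (node none (leaf 20) (leaf 24) none none)) (node none (node none (leaf 12) (leaf 16) (leaf 16) (leaf 20)) (node none (leaf 16) (leaf 20) (leaf 20) (leaf 24)) (node none (leaf 16) none none none) (node none (leaf 20) none none none)) none none))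
      (node none (node none (node none (node none (leaf 5) (leaf 9) (leaf 9) (leaf 13)) (node none (leaf 9) (leaf 13) (leaf 13) (leaf 17)) (node none (leaf 9) (leaf 13) (leaf 13) (leaf 17)) (node none (leaf 13) (leaf 17) (leaf 17) (leaf 21))) (node none (node none (leaf 9) (leaf 13) (leaf 13) (leaf 17)) (node none (leaf 13) (leaf 17) (leaf 17) (leaf 21)) (node none (leaf 13) (leaf 17) none none) (node none (leaf 17) (leaf 21) none none)) (node none (node none (leaf 9) (leaf 13) (leaf 13) (leaf 17)) (node none (leaf 13) (leaf 17) (leaf 17) (leaf 21)) (node none (leaf 13) none (leaf 17) none) (node none (leaf 17) none (leaf 21) none)) (node none (node none (leaf 13) (leaf 17) (leaf 17) (leaf 21)) (node none (leaf 17) (leaf 21) (leaf 21) (leaf 25)) none none)) none (node none (node none (node none (leaf 9) (leaf 13) (leaf 13) (leaf 17)) (node none (leaf 13) (leaf 17) (leaf 17) (leaf 21)) (node none (leaf 13) (leaf 17) (leaf 17) (leaf 21)) (node none (leaf 17) (leaf 21) none none)) none none none) none)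
      (node none (node none (node none (node none (leaf 9) (leaf 12) (leaf 13) (leaf 16)) (node none (leaf 12) (leaf 16) (leaf 16) (leaf 20)) (node none (leaf 13) (leaf 16) (leaf 17) (leaf 20)) (node none (leaf 16) (leaf 20) (leaf 20) (leaf 24))) (node none (node none (leaf 12) (leaf 16) (leaf 16) (leaf 20)) (node none (leaf 16) (leaf 20) (leaf 20) (leaf 24)) (node none (leaf 16) (leaf 20) none none) (node none (leaf 20) (leaf 24) none none)) none none) none (node none (node none (node none (leaf 13) (leaf 16) (leaf 17) (leaf 20)) (node none (leaf 16) (leaf 20) (leaf 20) (leaf 24)) (node none (leaf 17) (leaf 20) (leaf 21) (leaf 24)) (node none (leaf 20) (leaf 24) none none)) none none none) none))
    (node
      none
      (node none (node none (node none (node none (leaf 8) (leaf 12) (leaf 12) (leaf 16)) (node none (leaf 11) (leaf 15) (leaf 15) (leaf 19)) (node none (leaf 12) (leaf 16) (leaf 16) (leaf 20)) (node none (leaf 15) (leaf 19) (leaf 19) (leaf 23))) (node none (node none (leaf 10) (leaf 14) (leaf 14) (leaf 18)) (node none (leaf 14) (leaf 18) (leaf 18) (leaf 22)) (node none (leaf 14) none none none) (node none (leaf 18) none none none)) (node none (node none (leaf 12) (leaf 16) (leaf 16) (leaf 20)) (node none (leaf 15) (leaf 19) (leaf 19) (leaf 23)) (node none (leaf 16) none (leaf 20) none) (node none (leaf 19) none (leaf 23) none)) (node none (node none (leaf 14) (leaf 18) (leaf 18) (leaf 22)) (node none (leaf 18) (leaf 22) (leaf 22) (leaf 26)) (node none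 (leaf 18) none none none) (node none (leaf 22) none none none))) (node none (node none (node none (leaf 9) (leaf 13) (leaf 13) (leaf 17)) (node none (leaf 13) (leaf 17) (leaf 17) (leaf 21)) (node none (leaf 13) (leaf 17) (leaf 17) (leaf 21)) (node none (leaf 17) (leaf 21) (leaf 21) (leaf 25))) (node none (node none (leaf 13) (leaf 17) (leaf 17) (leaf 21)) (node none (leaf 17) (leaf 21) (leaf 21) (leaf 25)) (node none (leaf 17) none none none) (node none (leaf 21) none none none)) (node none (node none (leaf 13) (leaf 17) (leaf 17) (leaf 21)) (node none (leaf 17) (leaf 21) (leaf 21) (leaf 25)) none none) (node none (node none (leaf 17) (leaf 21) (leaf 21) (leaf 25)) (node none (leaf 21) (leaf 25) (leaf 25) (leaf 29)) none none)) (node none (node none (node none (leaf 11) (leaf 15) (leaf 15) (leaf 19)) (node none (leaf 15) (leaf 19) (leaf 19) (leaf 23)) (node none (leaf 15) (leaf 19) (leaf 19) (leaf 23)) (node none (leaf 19) (leaf 23) none none)) (node none (node none (leaf 14) (leaf 18) (leaf 18) (leaf 22)) (node none (leaf 18) (leaf 22) (leaf 22) (leaf 26)) (node none (leaf 18) none none none) (node none (leaf 22) none none none)) (node none (node none (leaf 15) (leaf 19) (leaf 19) (leaf 23)) none (node none (leaf 19) none none none) none) (node none (node none (leaf 18) (leaf 22) none none) none (node none (leaf 22) none none none) none)) (node none (node none (node none (leaf 13) (leaf 17) (leaf 17) (leaf 21)) (node none (leaf 17) (leaf 21) (leaf 21) (leaf 25)) (node none (leaf 17) (leaf 21) (leaf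 21) (leaf 25)) (node none (leaf 21) (leaf 25) none none)) (node none (node none (leaf 17) (leaf 21) (leaf 21) (leaf 25)) (node none (leaf 21) (leaf 25) (leaf 25) (leaf 29)) (node none (leaf 21) none none none) (node none (leaf 25) none none none)) none none))
      (node none (node none (node none (node none (leaf 9) (leaf 11) (leaf 13) (leaf 15)) (node none (leaf 11) (leaf 15) (leaf 15) (leaf 19)) (node none (leaf 13) (leaf 15) (leaf 17) (leaf 19)) (node none (leaf 15) (leaf 19) (leaf 19) (leaf 23))) (node none (node none (leaf 13) (leaf 15) (leaf 17) (leaf 19)) (node none (leaf 15) (leaf 19) (leaf 19) (leaf 23)) (node none (leaf 17) none none none) (node none (leaf 19) none none none)) (node none (node none (leaf 13) (leaf 15) (leaf 17) (leaf 19)) (node none (leaf 15) (leaf 19) (leaf 19) (leaf 23)) (node none (leaf 17) none (leaf 21) none) (node none (leaf 19) none (leaf 23) none)) (node none (node none (leaf 17) (leaf 19) (leaf 21) (leaf 23)) (node none (leaf 19) (leaf 23) (leaf 23) (leaf 27)) (node none (leaf 21) none none none) (node none (leaf 23) none none none))) (node none (node none (node none (leaf 13) (leaf 15) (leaf 17) (leaf 19)) (node none (leaf 15) (leaf 19) (leaf 19) (leaf 23)) (node none (leaf 17) (leaf 19) (leaf 21) (leaf 23)) (node none (leaf 19) (leaf 23) (leaf 23) (leaf 27))) (node none (node none (leaf 17) (leaf 19) (leaf 21) (leaf 23)) (node none (leaf 19) (leaf 23) (leaf 23) (leaf 27)) (node none (leaf 21) none none none) (node none (leaf 23) none none none)) (node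 none (node none (leaf 17) (leaf 19) (leaf 21) (leaf 23)) (node none (leaf 18) (leaf 22) (leaf 22) (leaf 26)) none none) (node none (node none (leaf 21) (leaf 23) (leaf 25) (leaf 27)) (node none (leaf 22) (leaf 26) (leaf 26) (leaf 30)) none none)) (node none (node none (node none (leaf 13) (leaf 15) (leaf 17) (leaf 19)) (node none (leaf 15) (leaf 19) (leaf 19) (leaf 23)) (node none (leaf 17) (leaf 19) (leaf 21) (leaf 23)) (node none (leaf 19) (leaf 23) none none)) (node none (node none (leaf 12) (leaf 16) (leaf 16) (leaf 20)) (node none (leaf 16) (leaf 20) (leaf 20) (leaf 24)) (node none (leaf 16) none none none) (node none (leaf 20) none none none)) none none) (node none (node none (node none (leaf 17) (leaf 19) (leaf 21) (leaf 23)) (node none (leaf 19) (leaf 23) (leaf 23) (leaf 27)) (node none (leaf 21) (leaf 23) (leaf 25) (leaf 27)) (node none (leaf 23) (leaf 27) none none)) (node none (node none (leaf 16) (leaf 20) (leaf 20) (leaf 24)) (node none (leaf 20) (leaf 24) (leaf 24) (leaf 28)) (node none (leaf 20) none none none) (node none (leaf 24) none none none)) none none))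
      (node none (node none (node none (node none (leaf 9) (leaf 13) (leaf 13) (leaf 17)) (node none (leaf 13) (leaf 17) (leaf 17) (leaf 21)) (node none (leaf 13) (leaf 17) (leaf 17) (leaf 21)) (node none (leaf 17) (leaf 21) (leaf 21) (leaf 25))) (node none (node none (leaf 13) (leaf 17) (leaf 17) (leaf 21)) (node none (leaf 17) (leaf 21) (leaf 21) (leaf 25)) (node none (leaf 17) none none none) (node none (leaf 21) none none none)) (node none (node none (leaf 13) (leaf 17) (leaf 17) (leaf 21)) (node none (leaf 17) (leaf 21) (leaf 21) (leaf 25)) (node none (leaf 17) none (leaf 21) none) (node none (leaf 21) none (leaf 25) none)) (node none (node none (leaf 17) (leaf 21) (leaf 21) (leaf 25)) (node none (leaf 21) (leaf 25) (leaf 25) (leaf 29)) none none)) none none none)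
      (node none (node none (node none (node none (leaf 13) (leaf 12) (leaf 17) (leaf 16)) (node none (leaf 12) (leaf 16) (leaf 16) (leaf 20)) (node none (leaf 17) (leaf 16) (leaf 21) (leaf 20)) (node none (leaf 16) (leaf 20) (leaf 20) (leaf 24))) (node none (node none (leaf 12) (leaf 16) (leaf 16) (leaf 20)) (node none (leaf 16) (leaf 20) (leaf 20) (leaf 24)) (node none (leaf 16) none none none) (node none (leaf 20) none none none)) none none) none none none))

table-v*∈S : Table 6
table-v*∈S =
  node
    (node
      (node (node (node (node (leaf 27) (leaf 22) (leaf 26) (leaf 26) (leaf 30)) (node none (leaf 17) (leaf 21) (leaf 21) (leaf 25)) (node none (leaf 21) none (leaf 25) none) (node none (leaf 21) (leaf 25) (leaf 25) (leaf 29)) (node none (leaf 25) none (leaf 29) none)) (node none (node none (leaf 12) (leaf 16) (leaf 16) (leaf 20)) (node none (leaf 16) none (leaf 20) none) (node none (leaf 16) (leaf 20) (leaf 20) (leaf 24)) (node none (leaf 20) none (leaf 24) none)) (node none (node none (leaf 16) (leaf 20) (leaf 20) (leaf 24)) none (node none (leaf 20) (leaf 24) none none) none) (node none (node none (leaf 16) (leaf 20) (leaf 20) (leaf 24)) (node none (leaf 20) none (leaf 24) none) (node none (leaf 20) none (leaf 24) none) (node none (leaf 24) none (leaf 28) none)) (node none (node none (leaf 20) (leaf 24) (leaf 24) (leaf 28)) none (node none (leaf 24) none none none) none)) (node none (node none (node none (leaf 7) (leaf 11) (leaf 11) (leaf 15)) (node none (leaf 11) none (leaf 15) none) (node none (leaf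 11) (leaf 15) (leaf 15) (leaf 19)) (node none (leaf 15) none (leaf 19) none)) (node none (node none (leaf 11) (leaf 15) (leaf 15) (leaf 19)) none (node none (leaf 15) (leaf 19) none none) none) (node none (node none (leaf 11) (leaf 15) (leaf 15) (leaf 19)) (node none (leaf 15) none (leaf 19) none) (node none (leaf 15) none (leaf 19) none) (node none (leaf 19) none (leaf 23) none)) (node none (node none (leaf 15) (leaf 19) (leaf 19) (leaf 23)) none (node none (leaf 19) none none none) none)) (node none (node none (node none (leaf 11) none (leaf 15) none) (node none (leaf 15) none (leaf 19) none) (node none (leaf 15) none (leaf 19) none) (node none (leaf 19) none (leaf 23) none)) none (node none (node none (leaf 15) none (leaf 19) none) (node none (leaf 19) none (leaf 23) none) none none) none) (node none (node none (node none (leaf 11) (leaf 15) (leaf 15) (leaf 19)) (node none (leaf 15) none (leaf 19) none) (node none (leaf 15) none (leaf 19) none) (node none (leaf 19) none none none)) (node none (node none (leaf 15) (leaf 19) (leaf 19) (leaf 23)) none (node none (leaf 19) none none none) none) (node none (node none (leaf 15) (leaf 19) (leaf 19) (leaf 23)) none (node none (leaf 19) none none none) none) (node none (node none (leaf 19) none none none) none (node none (leaf 23) none none none) none)) (node none (node none (node none (leaf 15) none (leaf 19) none) (node none (leaf 19) none (leaf 23) none) (node none (leaf 19) none (leaf 23) none) (node none (leaf 23) none none none)) none (node none (node none (leaf 19) none (leaf 23) none) none none none) none))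
      (node none (node none (node none (node none (leaf 2) (leaf 6) (leaf 6) (leaf 10)) (node none (leaf 6) none (leaf 10) none) (node none (leaf 6) (leaf 10) (leaf 10) (leaf 14)) (node none (leaf 10) none (leaf 14) none)) (node none (node none (leaf 6) (leaf 10) (leaf 10) (leaf 14)) none (node none (leaf 10) (leaf 14) none none) none) (node none (node none (leaf 6) (leaf 10) (leaf 10) (leaf 14)) (node none (leaf 10) none (leaf 14) none) (node none (leaf 10) none (leaf 14) none) (node none (leaf 14) none (leaf 18) none)) (node none (node none (leaf 10) (leaf 14) (leaf 14) (leaf 18)) none (node none (leaf 14) none none none) none)) (node none (node none (node none (leaf 6) none (leaf 10) none) (node none (leaf 10) none (leaf 14) none) (node none (leaf 10) none (leaf 14) none) (node none (leaf 14) none (leaf 18) none)) none (node none (node none (leaf 10) none (leaf 14) none) (node none (leaf 14) none (leaf 18) none) none none) none) (node none (node none (node none (leaf 6) (leaf 10) (leaf 10) (leaf 14)) (node none (leaf 10) none (leaf 14) none) (node none (leaf 10) none (leaf 14) none) (node none (leaf 14) none none none)) (node none (node none (leaf 10) (leaf 14) (leaf 14) (leaf 18)) none (node none (leaf 14) none none none) none) (node none (node none (leaf 10) (leaf 14) (leaf 14) (leaf 18)) none (node none (leaf 14) none none none) none) (node none (node none (leaf 14) none none none) none (node none (leaf 18) none none none) none)) (node none (node none (node none (leaf 10) none (leaf 14) none) (node none (leaf 14) none (leaf 18) none) (node none (leaf 14) none (leaf 18) none) (node none (leaf 18) none none none)) none (node none (node none (leaf 14) none (leaf 18) none) none none none)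 none))
      (node none (node none (node none (node none (leaf 6) none (leaf 10) none) none (node none (leaf 10) none (leaf 14) none) none) (node none (node none (leaf 10) none (leaf 14) none) none (node none (leaf 14) none none none) none) (node none (node none (leaf 10) none (leaf 14) none) none (node none (leaf 14) none (leaf 18) none) none) (node none (node none (leaf 14) none (leaf 18) none) none none none)) none (node none (node none (node none (leaf 10) none (leaf 14) none) none none none) (node none (node none (leaf 14) none (leaf 18) none) none none none) none none) none)
      (node none (node none (node none (node none (leaf 6) none (leaf 10) none) (node none (leaf 10) none (leaf 14) none) (node none (leaf 10) none (leaf 14) none) (node none (leaf 14) none (leaf 18) none)) (node none (node none (leaf 10) none (leaf 14) none) none (node none (leaf 14) none none none) none) (node none (node none (leaf 10) none (leaf 14) none) none (node none (leaf 14) none (leaf 18) none) none) (node none (node none (leaf 14) none (leaf 18) none) none none none)) (node none (node none (node none (leaf 10) none (leaf 14) none) (node none (leaf 14) none (leaf 18) none) (node none (leaf 14) none (leaf 18) none) (node none (leaf 18) none (leaf 22) none)) none (node none (node none (leaf 14) none (leaf 18) none) none none none) none) (node none (node none (node none (leaf 10) none (leaf 14) none) (node none (leaf 14) none (leaf 18) none) (node none (leaf 14) none (leaf 18) none) (node none (leaf 18) none none none)) none (node none (node none (leaf 14) none (leaf 18) none) none none none) none) (node none (node none (node none (leaf 14) none (leaf 18) none) none none none) none (node none (node none (leaf 18) none (leaf 22) none) none none none) none))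
      (node none (node none (node none (node none (leaf 10) none (leaf 14) none) none (node none (leaf 14) none (leaf 18) none) none) (node none (node none (leaf 14) none (leaf 18) none) none (node none (leaf 18) none none none) none) (node none (node none (leaf 14) none (leaf 18) none) none (node none (leaf 18) none (leaf 22) none) none) (node none (node none (leaf 18) none (leaf 22) none) none none none)) none (node none (node none (node none (leaf 14) none (leaf 18) none) none none none) none none none) none))
    (node
      none
      (node none (node none (node none (node none (leaf 0) (leaf 4) (leaf 4) (leaf 8)) (node none (leaf 1) none (leaf 5) none) (node none (leaf 3) (leaf 7) (leaf 7) (leaf 11)) (node none (leaf 5) none (leaf 9) none)) (node none (node none (leaf 1) (leaf 5) (leaf 5) (leaf 9)) none (node none (leaf 5) (leaf 9) none none) none) (node none (node none (leaf 1) (leaf 5) (leaf 5) (leaf 9)) (node none (leaf 5) none (leaf 9) none) (node none (leaf 5) none (leaf 9) none) (node none (leaf 9) none (leaf 13) none)) (node none (node none (leaf 5) (leaf 9) (leaf 9) (leaf 13)) none (node none (leaf 9) none none none) none)) (node none (node none (node none (leaf 1) none (leaf 5) none) (node none (leaf 5) none (leaf 9) none) (node none (leaf 5) none (leaf 9) none) (node none (leaf 9) none (leaf 13) none)) none (node none (node none (leaf 5) none (leaf 9) none) (node none (leaf 9) none (leaf 13) none) none none) none) (node none (node none (node none (leaf 4) (leaf 8) (leaf 8) (leaf 12)) (node none (leaf 5) none (leaf 9) none) (node none (leaf 5) none (leaf 9) none) (node none (leaf 9) none none none)) (node none (node none (leaf 5) (leaf 9) (leaf 9) (leaf 13)) none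 (node none (leaf 9) none none none) none) (node none (node none (leaf 5) (leaf 9) (leaf 9) (leaf 13)) none (node none (leaf 9) none none none) none) (node none (node none (leaf 9) none none none) none (node none (leaf 13) none none none) none)) (node none (node none (node none (leaf 5) none (leaf 9) none) (node none (leaf 9) none (leaf 13) none) (node none (leaf 9) none (leaf 13) none) (node none (leaf 13) none none none)) none (node none (node none (leaf 9) none (leaf 13) none) none none none) none))
      (node none (node none (node none (node none (leaf 4) none (leaf 8) none) none (node none (leaf 5) none (leaf 9) none) none) (node none (node none (leaf 5) none (leaf 9) none) none (node none (leaf 9) none none none) none) (node none (node none (leaf 5) none (leaf 9) none) none (node none (leaf 9) none (leaf 13) none) none) (node none (node none (leaf 9) none (leaf 13) none) none none none)) none (node none (node none (node none (leaf 8) none (leaf 12) none) none none none) (node none (node none (leaf 9) none (leaf 13) none) none none none) none none) none)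
      (node none (node none (node none (node none (leaf 4) none (leaf 8) none) (node none (leaf 5) none (leaf 9) none) (node none (leaf 5) none (leaf 9) none) (node none (leaf 9) none (leaf 13) none)) (node none (node none (leaf 5) none (leaf 9) none) none (node none (leaf 9) none none none) none) (node none (node none (leaf 5) none (leaf 9) none) none (node none (leaf 9) none (leaf 13) none) none) (node none (node none (leaf 9) none (leaf 13) none) none none none)) (node none (node none (node none (leaf 5) none (leaf 9) none) (node none (leaf 9) none (leaf 13) none) (node none (leaf 9) none (leaf 13) none) (node none (leaf 13) none (leaf 17) none)) none (node none (node none (leaf 9) none (leaf 13) none) none none none) none) (node none (node none (node none (leaf 8) none (leaf 12) none) (node none (leaf 9) none (leaf 13) none) (node none (leaf 9) none (leaf 13) none) (node none (leaf 13) none none none)) none (node none (node none (leaf 9) none (leaf 13) none) none none none) none) (node none (node none (node none (leaf 9) none (leaf 13) none) none none none) none (node none (node none (leaf 13) none (leaf 17) none) none none none) none))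
      (node none (node none (node none (node none (leaf 8) none (leaf 12) none) none (node none (leaf 9) none (leaf 13) none) none) (node none (node none (leaf 9) none (leaf 13) none) none (node none (leaf 13) none none none) none) (node none (node none (leaf 9) none (leaf 13) none) none (node none (leaf 13) none (leaf 17) none) none) (node none (node none (leaf 13) none (leaf 17) none) none none none)) none (node none (node none (node none (leaf 9) none (leaf 13) none) none none none) none none none) none))
    (node
      none
      (node none (node none (node none (node none (leaf 1) none (leaf 5) none) none none none) none (node none (node none (leaf 5) none (leaf 9) none) none none none) none) (node none (node none (node none (leaf 5) none (leaf 9) none) none none none) none (node none (node none (leaf 9) none (leaf 13) none) none none none) none) (node none (node none (node none (leaf 5) none (leaf 9) none) none none none) none (node none (node none (leaf 9) none (leaf 13) none) none none none) none) (node none (node none (node none (leaf 9) none (leaf 13) none) none none none) none none none))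
      none
      (node none (node none (node none (node none (leaf 5) none (leaf 9) none) none none none) none none none) (node none (node none (node none (leaf 9) none (leaf 13) none) none none none) none none none) none none)
      none)
    (node
      none
      (node none (node none (node none (node none (leaf 4) none (leaf 8) none) none (node none (leaf 5) none (leaf 9) none) none) (node none (node none (leaf 5) none (leaf 9) none) none (node none (leaf 9) none none none) none) (node none (node none (leaf 5) none (leaf 9) none) none (node none (leaf 9) none (leaf 13) none) none) (node none (node none (leaf 9) none (leaf 13) none) none (node none (leaf 13) none none none) none)) (node none (node none (node none (leaf 5) none (leaf 9) none) none (node none (leaf 9) none (leaf 13) none) none) none (node none (node none (leaf 9) none (leaf 13) none) none none none) none) (node none (node none (node none (leaf 5) none (leaf 9) none) none (node none (leaf 9) none (leaf 13) none) none) none (node none (node none (leaf 9) none (leaf 13) none) none (node none (leaf 13) none none none) none) none) (node none (node none (node none (leaf 9) none (leaf 13) none) none (node none (leaf 13) none (leaf 17) none) none) none none none))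
      (node none (node none (node none (node none (leaf 5) none (leaf 9) none) none (node none (leaf 9) none (leaf 13) none) none) (node none (node none (leaf 9) none (leaf 13) none) none (node none (leaf 13) none none none) none) (node none (node none (leaf 9) none (leaf 13) none) none (node none (leaf 13) none (leaf 17) none) none) (node none (node none (leaf 13) none (leaf 17) none) none none none)) none (node none (node none (node none (leaf 9) none (leaf 13) none) none none none) none none none) none)
      (node none (node none (node none (node none (leaf 5) none (leaf 9) none) none (node none (leaf 9) none (leaf 13) none) none) (node none (node none (leaf 9) none (leaf 13) none) none (node none (leaf 13) none none none) none) (node none (node none (leaf 9) none (leaf 13) none) none (node none (leaf 13) none (leaf 17) none) none) (node none (node none (leaf 13) none (leaf 17) none) none none none)) none (node none (node none (node none (leaf 9) none (leaf 13) none) none (node none (leaf 13) none (leaf 17) none) none) none none none) none)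
      (node none (node none (node none (node none (leaf 9) none (leaf 13) none) none (node none (leaf 13) none (leaf 17) none) none) none none none) none (node none (node none (node none (leaf 13) none (leaf 17) none) none none none) none none none) none))
    (node
      none
      (node none (node none (node none (node none (leaf 5) none (leaf 9) none) none none none) none (node none (node none (leaf 9) none (leaf 13) none) none none none) none) (node none (node none (node none (leaf 9) none (leaf 13) none) none none none) none (node none (node none (leaf 13) none (leaf 17) none) none none none) none) (node none (node none (node none (leaf 9) none (leaf 13) none) none none none) none (node none (node none (leaf 13) none (leaf 17) none) none none none) none) (node none (node none (node none (leaf 13) none (leaf 17) none) none none none) none none none))
      none
      (node none (node none (node none (node none (leaf 9) none (leaf 13) none) none none none) none none none) none none none)
      none)

table-v*∉S-potential : T (IsPotential false table-v*∉S)
table-v*∉S-potential = tt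

table-v*∈S-potential : T (IsPotential true table-v*∈S)
table-v*∈S-potential = tt

table-v*∉S-closing : T (ClosingBound false table-v*∉S 28)
table-v*∉S-closing = tt

table-v*∈S-closing : T (ClosingBound true table-v*∈S 24)
table-v*∈S-closing = tt

table-v*∉S-start : lookupT table-v*∉S (void ∷ void ∷ void ∷ void ∷ void ∷ void ∷ []) ≡ just 27
table-v*∉S-start = refl

table-v*∈S-start : lookupT table-v*∈S (void ∷ void ∷ void ∷ void ∷ void ∷ void ∷ []) ≡ just 27
table-v*∈S-start = refl

table : Bool → Table 6
table false = table-v*∉S
table true  = table-v*∈S

closing-value : Bool → ℕ
closing-value false = 28
closing-value true  = 24

table-potential : ∀ z → T (IsPotential z (table z))
table-potential false = table-v*∉S-potential
table-potential true  = table-v*∈S-potential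

table-closing : ∀ z → T (ClosingBound z (table z) (closing-value z))
table-closing false = table-v*∉S-closing
table-closing true  = table-v*∈S-closing

table-start : ∀ z → lookupT (table z) (void ∷ void ∷ void ∷ void ∷ void ∷ void ∷ []) ≡ just 27
table-start false = table-v*∉S-start
table-start true  = table-v*∈S-start

column : Maybe Bool → Maybe Bool → Column
column (just x) (just y) = col x y
column _        _        = void

-- Six void columns in front, so that a run starts in the all-void state.
columns : ∀ {n} → Vec Bool n → Vec Bool n → ℕ → Column
columns xs ys (suc (suc (suc (suc (suc (suc j)))))) = column (lookupℕ xs j) (lookupℕ ys j)
columns _  _  _                                     = void

uIn-column : ∀ a b → T (uIn (column a b)) → a ≡ just true
uIn-column (just true) (just _) _ = refl

u′In-column : ∀ a b → T (u′In (column a b)) → b ≡ just true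
u′In-column (just _) (just true) _ = refl

uOut-column : ∀ a b {y} → a ≡ just false → b ≡ just y → T (uOut (column a b))
uOut-column _ _ refl refl = tt

u′Out-column : ∀ a b {x} → b ≡ just false → a ≡ just x → T (u′Out (column a b))
u′Out-column _ _ refl refl = tt

⇒ᵇ-vacuous : ∀ a {r} → T ((a ∧ false) ⇒ᵇ r)
⇒ᵇ-vacuous true  = tt
⇒ᵇ-vacuous false = tt

padding-or-real : ∀ {n} (xs ys : Vec Bool n) q → columns xs ys q ≡ void ⊎ Σ ℕ λ i → q ≡ 6 + i
padding-or-real xs ys 0 = inj₁ refl
padding-or-real xs ys 1 = inj₁ refl
padding-or-real xs ys 2 = inj₁ refl
padding-or-real xs ys 3 = inj₁ refl
padding-or-real xs ys 4 = inj₁ refl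
padding-or-real xs ys 5 = inj₁ refl
padding-or-real xs ys (suc (suc (suc (suc (suc (suc i)))))) = inj₂ (i , refl)

module Constraints (n : ℕ) (z : Bool) (xs ys : Vec Bool n) where
  open Bridge n
  open Membership z xs ys
  open ShortWalks {Free}

  seq : ℕ → Column
  seq = columns xs ys

  member-u : ∀ j → T (uIn (seq (6 + j))) → Member (u j)
  member-u j = uIn-column (status (u j)) (status (u′ j))

  member-u′ : ∀ j → T (u′In (seq (6 + j))) → Member (u′ j)
  member-u′ j = u′In-column (status (u j)) (status (u′ j))

  free-u : ∀ j → Free (u j) → T (uOut (seq (6 + j)))
  free-u j f = uOut-column (status (u j)) (status (u′ j)) f (proj₂ (lookupℕ-< ys j (status⇒InRange (u j) f)))

  free-u′ : ∀ j → Free (u′ j) → T (u′Out (seq (6 + j)))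
  free-u′ j f = u′Out-column (status (u j)) (status (u′ j)) f (proj₂ (lookupℕ-< xs j (status⇒InRange (u′ j) f)))

  free-v* : Free v* → T (not z)
  free-v* refl = tt

  z-conflict : T z → Free v* → ⊥
  z-conflict hz f = subst T (just-injective f) hz

  uu′far-intro : ∀ b m → T (u′Out b) ⊎ T (u′Out m) → Free v* → T (not z ∧ (u′Out b ∨ u′Out m))
  uu′far-intro b m (inj₁ hb) f = free-v* f & ∨-introˡ (u′Out m) hb
  uu′far-intro b m (inj₂ hm) f = free-v* f & ∨-introʳ (u′Out b) hm

  uu′far-introʳ : ∀ i → (Free (u′ (1 + i)) × Free v*) ⊎ (Σ ℕ λ j → suc j ≡ i × Free (u′ j) × Free v*) →
                  T (not z ∧ (u′Out (seq (7 + i)) ∨ u′Out (seq (5 + i))))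
  uu′far-introʳ i (inj₁ (f₁ , f₂)) = uu′far-intro (seq (7 + i)) (seq (5 + i)) (inj₁ (free-u′ (1 + i) f₁)) f₂
  uu′far-introʳ i (inj₂ (j , refl , f₁ , f₂)) = uu′far-intro (seq (7 + i)) (seq (5 + i)) (inj₂ (free-u′ j f₁)) f₂

  module _ (mv : MutualVisibility M S) where

    uu3-holds : ∀ q → T (uu3 (seq q) (seq (1 + q)) (seq (2 + q)) (seq (3 + q)))
    uu3-holds q with padding-or-real xs ys q
    ... | inj₁ pad rewrite pad = tt
    ... | inj₂ (i , refl) = ⇒ᵇ-intro λ h →
      let (ha , hd) = ∧-split (uIn (seq (6 + i))) h
          md = member-u (3 + i) hd ; rd = status⇒InRange (u (3 + i)) md
      in case (walks-uu3 (shortcut mv (member-u i ha) md (uu+ ∷ uu+ ∷ uu+ ∷ [])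
                                      (m+n<o⇒n<o 3 rd , m+n<o⇒n<o 2 rd , m+n<o⇒n<o 1 rd , rd)))
      where
        b = seq (7 + i)
        c = seq (8 + i)
        case : (Free (u (1 + i)) × Free (u (2 + i))) ⊎ (Free (u′ (1 + i)) × Free (u (2 + i))) ⊎
               (Free (u (1 + i)) × Free (u′ (2 + i))) →
               T ((uOut b ∧ uOut c) ∨ (u′Out b ∧ uOut c) ∨ (uOut b ∧ u′Out c))
        case (inj₁ (f₁ , f₂)) = ∨-introˡ _ (free-u (1 + i) f₁ & free-u (2 + i) f₂)
        case (inj₂ (inj₁ (f₁ , f₂))) =
          ∨-introʳ (uOut b ∧ uOut c) (∨-introˡ (uOut b ∧ u′Out c) (free-u′ (1 + i) f₁ & free-u (2 + i) f₂))
        case (inj₂ (inj₂ (f₁ , f₂))) =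
          ∨-introʳ (uOut b ∧ uOut c) (∨-introʳ (u′Out b ∧ uOut c) (free-u (1 + i) f₁ & free-u′ (2 + i) f₂))

    uu′2-holds : ∀ q → T (uu′2 (seq q) (seq (1 + q)) (seq (2 + q)))
    uu′2-holds q with padding-or-real xs ys q
    ... | inj₁ pad rewrite pad = tt
    ... | inj₂ (i , refl) = ⇒ᵇ-intro λ h →
      let (ha , hc) = ∧-split (uIn (seq (6 + i))) h
          mc = member-u′ (2 + i) hc ; rc = status⇒InRange (u′ (2 + i)) mc
      in free-u (1 + i) (walks-uu′2ʳ (shortcut mv (member-u i ha) mc (uu+ ∷ uu′+ ∷ [])
                                                  (m+n<o⇒n<o 2 rc , m+n<o⇒n<o 1 rc , rc)))

    uu′2-holds⁻ : ∀ q → T (uu′2 (seq (2 + q)) (seq (1 + q)) (seq q))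
    uu′2-holds⁻ q with padding-or-real xs ys q
    ... | inj₁ pad rewrite pad = ⇒ᵇ-vacuous (uIn (seq (2 + q)))
    ... | inj₂ (i , refl) = ⇒ᵇ-intro λ h →
      let (ha , hc) = ∧-split (uIn (seq (8 + i))) h
          ma = member-u (2 + i) ha ; ra = status⇒InRange (u (2 + i)) ma
      in free-u (1 + i) (walks-uu′2ˡ (shortcut mv ma (member-u′ i hc) (uu- ∷ uu′- ∷ [])
                                                  (ra , m+n<o⇒n<o 1 ra , m+n<o⇒n<o 2 ra)))

    uu′3-holds : ∀ q → T (uu′3 z (seq q) (seq (1 + q)) (seq (2 + q)) (seq (3 + q)) (seq (4 + q)))
    uu′3-holds q with padding-or-real xs ys (suc q)
    ... | inj₁ pad rewrite pad = tt
    ... | inj₂ (i , refl) = ⇒ᵇ-intro λ h →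
      let (ha , hd) = ∧-split (uIn (seq (6 + i))) h
          md = member-u′ (3 + i) hd ; rd = status⇒InRange (u′ (3 + i)) md
      in case (walks-uu′3ʳ (shortcut mv (member-u i ha) md (uu+ ∷ uu+ ∷ uu′+ ∷ [])
                                        (m+n<o⇒n<o 3 rd , m+n<o⇒n<o 2 rd , m+n<o⇒n<o 1 rd , rd)))
      where
        b = seq (7 + i)
        c = seq (8 + i)
        case : (Free (u (1 + i)) × Free (u (2 + i))) ⊎ (Free (u′ (1 + i)) × Free (u (2 + i))) ⊎
               (Free (u′ (1 + i)) × Free v*) ⊎ (Σ ℕ λ j → suc j ≡ i × Free (u′ j) × Free v*) →
               T ((uOut b ∧ uOut c) ∨ (u′Out b ∧ uOut c) ∨ (u′Out b ∧ not z) ∨ (u′Out (seq (5 + i)) ∧ not z))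
        case (inj₁ (f₁ , f₂)) = ∨-introˡ _ (free-u (1 + i) f₁ & free-u (2 + i) f₂)
        case (inj₂ (inj₁ (f₁ , f₂))) =
          ∨-introʳ (uOut b ∧ uOut c) (∨-introˡ _ (free-u′ (1 + i) f₁ & free-u (2 + i) f₂))
        case (inj₂ (inj₂ (inj₁ (f₁ , f₂)))) =
          ∨-introʳ (uOut b ∧ uOut c) (∨-introʳ (u′Out b ∧ uOut c) (∨-introˡ _ (free-u′ (1 + i) f₁ & free-v* f₂)))
        case (inj₂ (inj₂ (inj₂ (j , refl , f₁ , f₂)))) =
          ∨-introʳ (uOut b ∧ uOut c) (∨-introʳ (u′Out b ∧ uOut c)
            (∨-introʳ (u′Out b ∧ not z) (free-u′ j f₁ & free-v* f₂)))

    uu′3-holds⁻ : ∀ q → T (uu′3 z (seq (4 + q)) (seq (3 + q)) (seq (2 + q)) (seq (1 + q)) (seq q))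
    uu′3-holds⁻ q with padding-or-real xs ys q
    ... | inj₁ pad rewrite pad = ⇒ᵇ-vacuous (uIn (seq (3 + q)))
    ... | inj₂ (i , refl) = ⇒ᵇ-intro λ h →
      let (ha , hd) = ∧-split (uIn (seq (9 + i))) h
          ma = member-u (3 + i) ha ; ra = status⇒InRange (u (3 + i)) ma
      in case (walks-uu′3ˡ (shortcut mv ma (member-u′ i hd) (uu- ∷ uu- ∷ uu′- ∷ [])
                                        (ra , m+n<o⇒n<o 1 ra , m+n<o⇒n<o 2 ra , m+n<o⇒n<o 3 ra)))
      where
        b = seq (8 + i)
        c = seq (7 + i)
        case : (Free (u (2 + i)) × Free (u (1 + i))) ⊎ (Free (u′ (2 + i)) × Free (u (1 + i))) ⊎
               (Free (u′ (2 + i)) × Free v*) ⊎ (Free (u′ (4 + i)) × Free v*) →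
               T ((uOut b ∧ uOut c) ∨ (u′Out b ∧ uOut c) ∨ (u′Out b ∧ not z) ∨ (u′Out (seq (10 + i)) ∧ not z))
        case (inj₁ (f₁ , f₂)) = ∨-introˡ _ (free-u (2 + i) f₁ & free-u (1 + i) f₂)
        case (inj₂ (inj₁ (f₁ , f₂))) =
          ∨-introʳ (uOut b ∧ uOut c) (∨-introˡ _ (free-u′ (2 + i) f₁ & free-u (1 + i) f₂))
        case (inj₂ (inj₂ (inj₁ (f₁ , f₂)))) =
          ∨-introʳ (uOut b ∧ uOut c) (∨-introʳ (u′Out b ∧ uOut c) (∨-introˡ _ (free-u′ (2 + i) f₁ & free-v* f₂)))
        case (inj₂ (inj₂ (inj₂ (f₁ , f₂)))) =
          ∨-introʳ (uOut b ∧ uOut c) (∨-introʳ (u′Out b ∧ uOut c)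
            (∨-introʳ (u′Out b ∧ not z) (free-u′ (4 + i) f₁ & free-v* f₂)))

    uu′4-holds : ∀ q → T (uu′far z (seq q) (seq (1 + q)) (seq (2 + q)) (seq (5 + q)))
    uu′4-holds q with padding-or-real xs ys (suc q)
    ... | inj₁ pad rewrite pad = tt
    ... | inj₂ (i , refl) = ⇒ᵇ-intro λ h →
      let (ha , he) = ∧-split (uIn (seq (6 + i))) h
          me = member-u′ (4 + i) he ; re = status⇒InRange (u′ (4 + i)) me
      in uu′far-introʳ i (walks-uu′4ʳ (shortcut mv (member-u i ha) me (uu′+ ∷ u′v* ∷ v*u′ ∷ [])
                                                   (m+n<o⇒n<o 4 re , m+n<o⇒n<o 3 re , tt , re)))

    uu′5-holds : ∀ q → T (uu′far z (seq q) (seq (1 + q)) (seq (2 + q)) (seq (6 + q)))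
    uu′5-holds q with padding-or-real xs ys (suc q)
    ... | inj₁ pad rewrite pad = tt
    ... | inj₂ (i , refl) = ⇒ᵇ-intro λ h →
      let (ha , he) = ∧-split (uIn (seq (6 + i))) h
          me = member-u′ (5 + i) he ; re = status⇒InRange (u′ (5 + i)) me
      in uu′far-introʳ i (walks-uu′5ʳ (shortcut mv (member-u i ha) me (uu′+ ∷ u′v* ∷ v*u′ ∷ [])
                                                   (m+n<o⇒n<o 5 re , m+n<o⇒n<o 4 re , tt , re)))

    uu′4-holds⁻ : ∀ q → T (uu′far z (seq (5 + q)) (seq (4 + q)) (seq (3 + q)) (seq q))
    uu′4-holds⁻ q with padding-or-real xs ys q
    ... | inj₁ pad rewrite pad = ⇒ᵇ-vacuous (uIn (seq (4 + q)))
    ... | inj₂ (i , refl) = ⇒ᵇ-intro λ h →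
      let (ha , he) = ∧-split (uIn (seq (10 + i))) h
          ma = member-u (4 + i) ha ; ra = status⇒InRange (u (4 + i)) ma
      in case (walks-uu′4ˡ (shortcut mv ma (member-u′ i he) (uu′- ∷ u′v* ∷ v*u′ ∷ [])
                                        (ra , m+n<o⇒n<o 1 ra , tt , m+n<o⇒n<o 4 ra)))
      where
        case : (Free (u′ (5 + i)) × Free v*) ⊎ (Free (u′ (3 + i)) × Free v*) →
               T (not z ∧ (u′Out (seq (9 + i)) ∨ u′Out (seq (11 + i))))
        case (inj₁ (f₁ , f₂)) = uu′far-intro (seq (9 + i)) (seq (11 + i)) (inj₂ (free-u′ (5 + i) f₁)) f₂
        case (inj₂ (f₁ , f₂)) = uu′far-intro (seq (9 + i)) (seq (11 + i)) (inj₁ (free-u′ (3 + i) f₁)) f₂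

    uu′5-holds⁻ : ∀ q → T (uu′far z (seq (6 + q)) (seq (5 + q)) (seq (4 + q)) (seq q))
    uu′5-holds⁻ q with padding-or-real xs ys q
    ... | inj₁ pad rewrite pad = ⇒ᵇ-vacuous (uIn (seq (5 + q)))
    ... | inj₂ (i , refl) = ⇒ᵇ-intro λ h →
      let (ha , he) = ∧-split (uIn (seq (11 + i))) h
          ma = member-u (5 + i) ha ; ra = status⇒InRange (u (5 + i)) ma
      in case (walks-uu′5ˡ (shortcut mv ma (member-u′ i he) (uu′- ∷ u′v* ∷ v*u′ ∷ [])
                                        (ra , m+n<o⇒n<o 1 ra , tt , m+n<o⇒n<o 5 ra)))
      where
        case : (Free (u′ (6 + i)) × Free v*) ⊎ (Free (u′ (4 + i)) × Free v*) →
               T (not z ∧ (u′Out (seq (10 + i)) ∨ u′Out (seq (12 + i))))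
        case (inj₁ (f₁ , f₂)) = uu′far-intro (seq (10 + i)) (seq (12 + i)) (inj₂ (free-u′ (6 + i) f₁)) f₂
        case (inj₂ (f₁ , f₂)) = uu′far-intro (seq (10 + i)) (seq (12 + i)) (inj₁ (free-u′ (4 + i) f₁)) f₂

    u′u′-holds : ∀ {d} → Apart d → ∀ q → T (u′u′ z (seq q) (seq (d + q)))
    u′u′-holds {d} apart q with padding-or-real xs ys q
    ... | inj₁ pad rewrite pad = ⇒ᵇ-true z
    ... | inj₂ (i , refl) = ⇒ᵇ-intro λ hz → not-intro λ h →
      let (ha , hb) = ∧-split (u′In (seq (6 + i))) h
          ma = member-u′ i ha
          mb = member-u′ (d + i) (subst (λ k → T (u′In (seq k))) (m+[6+n]≡6+[m+n] d i) hb)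
      in z-conflict hz (walks-u′u′ʳ apart (shortcut mv ma mb (u′v* ∷ v*u′ ∷ [])
           (status⇒InRange (u′ i) ma , tt , status⇒InRange (u′ (d + i)) mb)))

    window-holds : ∀ p → T (allowed z (window seq p) (seq (6 + p)))
    window-holds p =
      (uu3-holds p & uu3-holds (1 + p) & uu3-holds (2 + p) & uu3-holds (3 + p)) &
      (uu′2-holds p & uu′2-holds (1 + p) & uu′2-holds (2 + p) & uu′2-holds (3 + p) & uu′2-holds (4 + p)) &
      (uu′2-holds⁻ p & uu′2-holds⁻ (1 + p) & uu′2-holds⁻ (2 + p) & uu′2-holds⁻ (3 + p) & uu′2-holds⁻ (4 + p)) &
      (uu′3-holds p & uu′3-holds (1 + p) & uu′3-holds (2 + p)) &
      (uu′3-holds⁻ p & uu′3-holds⁻ (1 + p) & uu′3-holds⁻ (2 + p)) &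
      (uu′4-holds p & uu′4-holds (1 + p) & uu′5-holds p) &
      (uu′4-holds⁻ p & uu′4-holds⁻ (1 + p) & uu′5-holds⁻ p) &
      (u′u′-holds apart1 p & u′u′-holds apart1 (1 + p) & u′u′-holds apart1 (2 + p) & u′u′-holds apart1 (3 + p) &
       u′u′-holds apart1 (4 + p) & u′u′-holds apart1 (5 + p)) &
      (u′u′-holds apart3 p & u′u′-holds apart3 (1 + p) & u′u′-holds apart3 (2 + p) & u′u′-holds apart3 (3 + p)) &
      (u′u′-holds apart4 p & u′u′-holds apart4 (1 + p) & u′u′-holds apart4 (2 + p)) &
      (u′u′-holds apart5 p & u′u′-holds apart5 (1 + p))

columns-real : ∀ {m} (xs ys : Vec Bool m) j → j < m → Real (columns xs ys (6 + j))
columns-real xs ys j j<m with lookupℕ-< xs j j<m | lookupℕ-< ys j j<m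
... | _ , ex | _ , ey rewrite ex | ey = tt

columns-tail : ∀ {m} (xs ys : Vec Bool m) j → columns xs ys (6 + (j + m)) ≡ void
columns-tail {m} xs ys j rewrite lookupℕ-≥ xs (j + m) (m≤n+m m j) = refl

weightSum-columns-∷ : ∀ {m} x y (xs ys : Vec Bool m) p k →
                      weightSum (columns (x ∷ xs) (y ∷ ys)) (suc p) k ≡ weightSum (columns xs ys) p k
weightSum-columns-∷ x y xs ys p zero    = refl
weightSum-columns-∷ x y xs ys p (suc k) = cong (weight (columns xs ys (6 + p)) +_) (weightSum-columns-∷ x y xs ys (suc p) k)

weightSum-columns : ∀ {m} (xs ys : Vec Bool m) → weightSum (columns xs ys) 0 m ≡ ∣ xs ∣ + ∣ ys ∣
weightSum-columns []       []       = refl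
weightSum-columns {suc m} (x ∷ xs) (y ∷ ys) = begin
  bit x + bit y + weightSum (columns (x ∷ xs) (y ∷ ys)) 1 m
    ≡⟨ cong (bit x + bit y +_) (trans (weightSum-columns-∷ x y xs ys 0 m) (weightSum-columns xs ys)) ⟩
  bit x + bit y + (∣ xs ∣ + ∣ ys ∣)
    ≡⟨ solve 4 (λ a b c d → a :+ b :+ (c :+ d) := a :+ c :+ (b :+ d)) refl (bit x) (bit y) ∣ xs ∣ ∣ ys ∣ ⟩
  bit x + ∣ xs ∣ + (bit y + ∣ ys ∣)
    ≡⟨ sym (cong₂ _+_ (∣b∷p∣≡bit+∣p∣ x xs) (∣b∷p∣≡bit+∣p∣ y ys)) ⟩
  ∣ x ∷ xs ∣ + ∣ y ∷ ys ∣ ∎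
  where open ≡-Reasoning

quarter-bound : ∀ n a → 4 * a ≤ 5 * n + 1 → a ≤ n + suc n / 4
quarter-bound n a 4a≤5n+1 = begin
  a                     ≡⟨ sym (m*n/n≡m a 4) ⟩
  a * 4 / 4             ≤⟨ /-monoˡ-≤ 4 (subst (_≤ 5 * n + 1) (*-comm 4 a) 4a≤5n+1) ⟩
  (5 * n + 1) / 4       ≡⟨ /-congˡ (solve 1 (λ n → con 5 :* n :+ con 1 := con 4 :* n :+ (con 1 :+ n)) refl n) ⟩
  (4 * n + suc n) / 4   ≡⟨ +-distrib-/-∣ˡ (suc n) (m∣m*n n) ⟩
  4 * n / 4 + suc n / 4 ≡⟨ cong (_+ suc n / 4) (trans (cong (_/ 4) (*-comm 4 n)) (m*n/n≡m n 4)) ⟩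
  n + suc n / 4         ∎
  where open ≤-Reasoning

closing⇒bound : ∀ z a N → 4 * a + 27 ≤ N + closing-value z → 4 * (bit z + a) ≤ N + 1
closing⇒bound false a N le =
  +-cancelʳ-≤ 27 (4 * a) (N + 1) (subst (4 * a + 27 ≤_) (solve 1 (λ N → N :+ con 28 := N :+ con 1 :+ con 27) refl N) le)
closing⇒bound true  a N le =
  +-cancelʳ-≤ 23 (4 * (1 + a)) (N + 1)
    (subst₂ _≤_ (solve 1 (λ a → con 4 :* a :+ con 27 := con 4 :* (con 1 :+ a) :+ con 23) refl a)
                (solve 1 (λ N → N :+ con 24 := N :+ con 1 :+ con 23) refl N) le)

upper-bound-split : ∀ m z (xs ys : Vec Bool (5 + m)) → MutualVisibility (Mycielskian (Path (5 + m))) (z ∷ (xs ++ ys)) →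
                    4 * ∣ z ∷ (xs ++ ys) ∣ ≤ 5 * (5 + m) + 1
upper-bound-split m z xs ys mv =
  subst (λ a → 4 * a ≤ 5 * (5 + m) + 1)
        (sym (trans (∣b∷p∣≡bit+∣p∣ z (xs ++ ys)) (cong (bit z +_) (∣p++q∣≡∣p∣+∣q∣ xs ys))))
        (closing⇒bound z _ _ (subst (λ w → 4 * w + 27 ≤ 5 * (5 + m) + closing-value z) (weightSum-columns xs ys) run-bound))
  where
    open Constraints (5 + m) z xs ys
    run-bound : 4 * weightSum seq 0 (5 + m) + 27 ≤ 5 * (5 + m) + closing-value z
    run-bound = Run.weight-bound z (table z) (table-potential z) seq (window-holds mv) (closing-value z) (table-closing z) m
                          (table-start z) (columns-real xs ys) (columns-tail xs ys)

upper-bound : ∀ n → 5 ≤ n → (S : Subset (size (Mycielskian (Path n)))) → MutualVisibility (Mycielskian (Path n)) S →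
              ∣ S ∣ ≤ n + suc n / 4
upper-bound (suc (suc (suc (suc (suc m))))) (s≤s (s≤s (s≤s (s≤s (s≤s _))))) (z ∷ r) mv with Vec.splitAt (5 + m) r
... | xs , ys , refl = quarter-bound (5 + m) _ (upper-bound-split m z xs ys mv)

lower-bound : ∀ n → 1 < n →
              Σ (Subset (size (Mycielskian (Path n)))) λ S → MutualVisibility (Mycielskian (Path n)) S × ∣ S ∣ ≡ n + suc n / 4
lower-bound n 1<n =
  _ , LowerBound.mutual-visibility n 1<n , trans (∣p++q∣≡∣p∣+∣q∣ (uPattern n) (u′Pattern n)) (∣pattern∣ n)

theorem5p1 : (n : ℕ) → 5 ≤ n → IsMu (Mycielskian (Path n)) (n + (suc n / 4))
theorem5p1 n 5≤n = lower-bound n (≤-trans (s≤s (s≤s z≤n)) 5≤n) , upper-bound n 5≤n
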